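{- Let $w_0=(n,n-1,\dots,2,1)\in S_n$, let $\mathbf m$ be the reduced word for $w_0$ given by the concatenation $(1,\ 2,1,\ 3,2,1,\ \dots,\ n-1,n-2,\dots,2,1)$ (the blocks $(k,k-1,\dots,1)$ for $k=1,\dots,n-1$), and let $C=C(\mathbf m)$. Then the uniform vote tally $\rho=\mathbb 1_{\operatorname{Pre}(C)}$ has majority relation $\triangleleft_\rho$ equal to the prelinear order whose ordered set partition of $[n]$ has blocks $\{a,n+1-a\}$ for $a=1,\dots,\lceil n/2\rceil$, listed in decreasing order of $a$; that is, for $n$ even it is $\{\tfrac n2,\tfrac n2+1\},\dots,\{3,n-2\},\{2,n-1\},\{1,n\}$, and for $n$ odd it is $\{\tfrac{n+1}2\},\{\tfrac{n-1}2,\tfrac{n+3}2\},\dots,\{2,n-1\},\{1,n\}$.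
   Context: For $w=(w_1,\dots,w_n)\in S_n$, $<_w$ denotes the linear order $w_1<_w\cdots<_w w_n$ on $[n]$, and $\operatorname{Inv}(w)=\{(a,b):1\le a<b\le n,\ b<_w a\}$. Let $s_i$ be the adjacent transposition of $i,i+1$; $ws_i$ is obtained from $w$ by swapping the entries in positions $i,i+1$. A reduced word for $w$ is $(i_1,\dots,i_\ell)$ with $w=s_{i_1}\cdots s_{i_\ell}$, $\ell=|\operatorname{Inv}(w)|$. The commutation class $C(\mathbf i)$ is the set of words obtained from $\mathbf i$ by repeatedly swapping adjacent entries differing by at least $2$. $\operatorname{Pre}(C)$ is the set of all $s_{i'_1}\cdots s_{i'_m}$ with $(i'_1,\dots,i'_m)$ a prefix of a word in $C$. The uniform vote tally $\mathbb 1_{\operatorname{Pre}(C)}$ is $1$ on $\operatorname{Pre}(C)$ and $0$ elsewhere on $S_n$. For a vote tally $\rho:S_n\to\mathbb N$, the majority relation is $a\triangleleft_\rho b$ iff $\sum_{w':\,a<_{w'}b}\rho(w')>\sum_{w':\,b<_{w'}a}\rho(w')$. A prelinear order with ordered set partition $(B_1,\dots,B_m)$ of $[n]$ is the relation $a\prec b$ iff $a\in B_r$, $b\in B_s$ with $r<s$. -}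

module Defs where

open import Data.Nat using (ℕ; zero; suc; _∸_; _≤_; _<_; ⌈_/2⌉; ∣_-_∣)
open import Data.List using (List; []; _∷_; _++_; map; foldl; upTo; length; lookup)
open import Data.List.Membership.Propositional using (_∈_)
open import Data.List.Relation.Unary.Unique.Propositional using (Unique)
open import Data.Fin as Fin using (Fin)
open import Data.Product using (Σ; ∃; _×_; _,_)
open import Function.Bundles using (_⇔_)
open import Relation.Binary.PropositionalEquality using (_≡_)
open import Relation.Binary.Construct.Closure.ReflexiveTransitive using (Star)

-- Elements of [n] are the naturals 1..n.  A permutation w ∈ S_n is given in
-- one-line notation as the list (w_1, …, w_n).
Word : Set
Word = List ℕ

OneLine : Set
OneLine = List ℕ

idPerm : ℕ → OneLine
idPerm n = map suc (upTo n)

-- w ↦ w s_i : swap the entries in (1-based) positions i, i+1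
swapAt : ℕ → OneLine → OneLine
swapAt (suc zero) (x ∷ y ∷ zs) = y ∷ x ∷ zs
swapAt (suc (suc i)) (x ∷ xs) = x ∷ swapAt (suc i) xs
swapAt _ xs = xs

-- s_{i_1} ⋯ s_{i_m} ∈ S_n, computed as id · s_{i_1} · … · s_{i_m}
evalWord : ℕ → Word → OneLine
evalWord n ws = foldl (λ w i → swapAt i w) (idPerm n) ws

Before : OneLine → ℕ → ℕ → Set
Before w a b = Σ OneLine λ xs → Σ OneLine λ ys → Σ OneLine λ zs →
  w ≡ xs ++ (a ∷ ys ++ (b ∷ zs))

data CommStep : Word → Word → Set where
  comm : ∀ (xs ys : Word) (i j : ℕ) → 2 ≤ ∣ i - j ∣ →
         CommStep (xs ++ (i ∷ j ∷ ys)) (xs ++ (j ∷ i ∷ ys))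

InCommClass : Word → Word → Set
InCommClass i j = Star CommStep i j

InPre : ℕ → Word → OneLine → Set
InPre n i w = Σ Word λ j → InCommClass i j × Σ Word λ p → Σ Word λ q →
  (j ≡ p ++ q) × (evalWord n p ≡ w)

HasSize : (OneLine → Set) → ℕ → Set
HasSize P k = Σ (List OneLine) λ xs →
  Unique xs × (∀ w → (w ∈ xs) ⇔ P w) × (length xs ≡ k)

-- majority relation of the uniform vote tally 1_{Pre(C(i))}:
-- Σ_{w : a <_w b} 1_{Pre}(w) > Σ_{w : b <_w a} 1_{Pre}(w)
UniformMajority : ℕ → Word → ℕ → ℕ → Set
UniformMajority n i a b = Σ ℕ λ k₁ → Σ ℕ λ k₂ →
  HasSize (λ w → InPre n i w × Before w a b) k₁ ×
  HasSize (λ w → InPre n i w × Before w b a) k₂ × (k₂ < k₁)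

Prelinear : List (List ℕ) → ℕ → ℕ → Set
Prelinear B a b = Σ (Fin (length B)) λ r → Σ (Fin (length B)) λ s →
  (r Fin.< s) × (a ∈ lookup B r) × (b ∈ lookup B s)

desc : ℕ → List ℕ
desc zero = []
desc (suc k) = suc k ∷ desc k

mWord : ℕ → Word
mWord zero = []
mWord (suc k) = mWord k ++ desc k

partBlocks : ℕ → List (List ℕ)
partBlocks n = map (λ a → a ∷ (suc n ∸ a) ∷ []) (desc ⌈ n /2⌉)

module Submission where

-- Pre(C(m)) is the set of permutations avoiding the patterns 132 and 312: those built from (1)
-- by repeatedly appending a new largest entry, or a new smallest entry after shifting the others
-- up. All of them are reached because m is commutation equivalent to (1, 2, …, n-1) followed by
-- the word m for n - 1; conversely, "every prefix evaluates to an avoider" survives each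
-- commutation move. Splitting by the last entry, the number of these permutations with a before
-- b satisfies a recursion showing that it is symmetric under x ↦ n + 1 - x and strictly favours
-- the entry closer to the centre; comparing distances to the centre is exactly the prelinear
-- order of the blocks {a, n + 1 - a}.

open import Defs
open import Data.Bool using (true; false)
open import Data.Empty using (⊥; ⊥-elim)
open import Data.Fin as Fin using (Fin)
open import Data.Nat using (ℕ; zero; suc; pred; _+_; _∸_; _≤_; _<_; z≤n; s≤s; _≟_; _≤?_; ∣_-_∣; ⌊_/2⌋; ⌈_/2⌉)
open import Data.Nat.Properties
open import Algebra.Properties.CommutativeSemigroup +-commutativeSemigroup using (interchange)
open import Data.List
  using (List; []; _∷_; _++_; _∷ʳ_; [_]; map; foldl; length; filter; upTo; take; drop; initLast; _∷ʳ′_; lookup)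
open import Data.List.Properties
  using (++-assoc; ++-identityʳ; ∷-injective; length-++; length-map; length-take; foldl-++; map-++;
         upTo-∷ʳ; map-applyUpTo; length-upTo; take++drop≡id; filter-all; filter-none; filter-++;
         ∷ʳ-injectiveˡ; ∷ʳ-injectiveʳ; map-injective)
open import Data.List.Membership.Propositional using (_∈_; _∉_)
open import Data.List.Membership.DecPropositional _≟_ using (_∈?_)
open import Data.List.Membership.Propositional.Properties
  using (∈-++⁺ˡ; ∈-++⁺ʳ; ∈-++⁻; ∈-map⁺; ∈-map⁻; ∈-∃++; ∈-upTo⁺; ∈-upTo⁻; ∈-filter⁺; ∈-filter⁻)
open import Data.List.Membership.Propositional.Properties.WithK using (unique∧set⇒bag)
open import Data.List.Relation.Binary.BagAndSetEquality using (∼bag⇒↭)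
open import Data.List.Relation.Binary.Permutation.Propositional.Properties using (↭-length)
open import Data.List.Relation.Unary.Any using (here; there)
open import Data.List.Relation.Unary.All as All using (All; []; _∷_)
open import Data.List.Relation.Unary.AllPairs as AllPairs using (AllPairs; []; _∷_)
import Data.List.Relation.Unary.AllPairs.Properties as AllPairs
import Data.List.Relation.Unary.All.Properties as All
import Data.List.Relation.Unary.Unique.Propositional.Properties as Unique
open import Data.List.Relation.Unary.Unique.Propositional using (Unique)
open import Data.Product using (Σ; _×_; _,_; proj₁; proj₂)
open import Data.Sum using (_⊎_; inj₁; inj₂)
open import Function using (id; _∘_; _⟨_⟩_)
open import Function.Bundles using (_⇔_; mk⇔; Equivalence)
import Function.Properties.Equivalence as ⇔
open import Relation.Binary.Construct.Closure.ReflexiveTransitive as Star using (Star; ε; _◅_; _◅◅_)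
open import Relation.Binary.Definitions using (tri<; tri≈; tri>)
open import Relation.Binary.PropositionalEquality hiding ([_])
open import Relation.Nullary using (¬_; Dec; yes; no; does)
open import Relation.Nullary.Decidable using (map′; _×-dec_; _⊎-dec_)
import Relation.Unary as U

data Precedes : OneLine → ℕ → ℕ → Set where
  now   : ∀ {x y xs} → y ∈ xs → Precedes (x ∷ xs) x y
  later : ∀ {z x y xs} → Precedes xs x y → Precedes (z ∷ xs) x y

Before⇒Precedes : ∀ {w a b} → Before w a b → Precedes w a b
Before⇒Precedes {a = a} {b} (xs , ys , zs , refl) = go xs
  where
  go : ∀ xs → Precedes (xs ++ a ∷ ys ++ b ∷ zs) a b
  go []       = now (∈-++⁺ʳ ys (here refl))
  go (_ ∷ xs) = later (go xs)

Precedes⇒Before : ∀ {w a b} → Precedes w a b → Before w a b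
Precedes⇒Before (now b∈) with ys , zs , refl ← ∈-∃++ b∈ = [] , ys , zs , refl
Precedes⇒Before {z ∷ _} (later p) with xs , ys , zs , refl ← Precedes⇒Before p = z ∷ xs , ys , zs , refl

precedes? : ∀ w a b → Dec (Precedes w a b)
precedes? []      a b = no λ ()
precedes? (x ∷ w) a b = map′ fromCases toCases ((x ≟ a ×-dec b ∈? w) ⊎-dec precedes? w a b)
  where
  fromCases : (x ≡ a × b ∈ w) ⊎ Precedes w a b → Precedes (x ∷ w) a b
  fromCases (inj₁ (refl , b∈)) = now b∈
  fromCases (inj₂ p)           = later p
  toCases : Precedes (x ∷ w) a b → (x ≡ a × b ∈ w) ⊎ Precedes w a b
  toCases (now b∈)  = inj₁ (refl , b∈)
  toCases (later p) = inj₂ p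

Precedes⇒∈ˡ : ∀ {w a b} → Precedes w a b → a ∈ w
Precedes⇒∈ˡ (now _)   = here refl
Precedes⇒∈ˡ (later p) = there (Precedes⇒∈ˡ p)

Precedes⇒∈ʳ : ∀ {w a b} → Precedes w a b → b ∈ w
Precedes⇒∈ʳ (now b∈)  = there b∈
Precedes⇒∈ʳ (later p) = there (Precedes⇒∈ʳ p)

Precedes-irrefl : ∀ {w a} → Unique w → ¬ Precedes w a a
Precedes-irrefl (a∉ ∷ _)  (now a∈)  = All.lookup a∉ a∈ refl
Precedes-irrefl (_ ∷ w!)  (later p) = Precedes-irrefl w! p

Precedes-++ʳ : ∀ {v a b} zs → Precedes v a b → Precedes (v ++ zs) a b
Precedes-++ʳ zs (now b∈)  = now (∈-++⁺ˡ b∈)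
Precedes-++ʳ zs (later p) = later (Precedes-++ʳ zs p)

Precedes-∷ʳ-last : ∀ {a} v c → a ∈ v → Precedes (v ∷ʳ c) a c
Precedes-∷ʳ-last (_ ∷ v) c (here refl) = now (∈-++⁺ʳ v (here refl))
Precedes-∷ʳ-last (_ ∷ v) c (there a∈)  = later (Precedes-∷ʳ-last v c a∈)

Precedes-∷ʳ⁻ˡ : ∀ {a b} v c → Precedes (v ∷ʳ c) a b → a ∈ v
Precedes-∷ʳ⁻ˡ []      c (later ())
Precedes-∷ʳ⁻ˡ (_ ∷ v) c (now _)   = here refl
Precedes-∷ʳ⁻ˡ (_ ∷ v) c (later p) = there (Precedes-∷ʳ⁻ˡ v c p)

Precedes-∷ʳ⁻ : ∀ {a b} v c → b ≢ c → Precedes (v ∷ʳ c) a b → Precedes v a b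
Precedes-∷ʳ⁻ []      c b≢c (now ())
Precedes-∷ʳ⁻ []      c b≢c (later ())
Precedes-∷ʳ⁻ (_ ∷ v) c b≢c (now b∈) with ∈-++⁻ v b∈
... | inj₁ b∈v          = now b∈v
... | inj₂ (here b≡c)   = ⊥-elim (b≢c b≡c)
Precedes-∷ʳ⁻ (_ ∷ v) c b≢c (later p) = later (Precedes-∷ʳ⁻ v c b≢c p)

Precedes-∷ʳ : ∀ {a b} v c → b ≢ c → Precedes (v ∷ʳ c) a b ⇔ Precedes v a b
Precedes-∷ʳ v c b≢c = mk⇔ (Precedes-∷ʳ⁻ v c b≢c) (Precedes-++ʳ [ c ])

Precedes-map-suc⁺ : ∀ {w a b} → Precedes w a b → Precedes (map suc w) (suc a) (suc b)
Precedes-map-suc⁺ (now b∈)  = now (∈-map⁺ suc b∈)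
Precedes-map-suc⁺ (later p) = later (Precedes-map-suc⁺ p)

Precedes-map-suc⁻ : ∀ {w a b} → Precedes (map suc w) (suc a) (suc b) → Precedes w a b
Precedes-map-suc⁻ {_ ∷ _} (now b∈) with _ , b∈w , refl ← ∈-map⁻ suc b∈ = now b∈w
Precedes-map-suc⁻ {_ ∷ _} (later p) = later (Precedes-map-suc⁻ p)

Precedes-remove : ∀ {a b} ys c zs → a ≢ c → b ≢ c → Precedes (ys ++ c ∷ zs) a b → Precedes (ys ++ zs) a b
Precedes-remove []       c zs a≢c b≢c (now _)   = ⊥-elim (a≢c refl)
Precedes-remove []       c zs a≢c b≢c (later p) = p
Precedes-remove (_ ∷ ys) c zs a≢c b≢c (now b∈) with ∈-++⁻ ys b∈
... | inj₁ b∈ys          = now (∈-++⁺ˡ b∈ys)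
... | inj₂ (here b≡c)    = ⊥-elim (b≢c b≡c)
... | inj₂ (there b∈zs)  = now (∈-++⁺ʳ ys b∈zs)
Precedes-remove (_ ∷ ys) c zs a≢c b≢c (later p) = later (Precedes-remove ys c zs a≢c b≢c p)

Precedes-AllPairs : ∀ {R : ℕ → ℕ → Set} {w a b} → AllPairs R w → Precedes w a b → R a b
Precedes-AllPairs (a≺ ∷ _) (now b∈)  = All.lookup a≺ b∈
Precedes-AllPairs (_ ∷ w≺) (later p) = Precedes-AllPairs w≺ p

InRange : ℕ → ℕ → Set
InRange n a = 1 ≤ a × a ≤ n

inRange? : ∀ n a → Dec (InRange n a)
inRange? n a = 1 ≤? a ×-dec a ≤? n

record IsPerm (n : ℕ) (w : OneLine) : Set where
  field
    unique  : Unique w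
    bounded : ∀ {x} → x ∈ w → InRange n x
    onto    : ∀ {x} → 1 ≤ x → x ≤ n → x ∈ w

unique-∷ʳ⁺ : ∀ {v} {c : ℕ} → Unique v → c ∉ v → Unique (v ∷ʳ c)
unique-∷ʳ⁺ v! c∉ = Unique.++⁺ v! ([] ∷ []) λ { (c∈ , here refl) → c∉ c∈ }

unique-∷ʳ⁻ : ∀ v {c : ℕ} → Unique (v ∷ʳ c) → Unique v × c ∉ v
unique-∷ʳ⁻ []      _              = [] , λ ()
unique-∷ʳ⁻ (x ∷ v) (x∉vc ∷ vc!) with v! , c∉v ← unique-∷ʳ⁻ v vc! =
  All.++⁻ˡ v x∉vc ∷ v! , λ { (here refl) → All.lookup (All.++⁻ʳ v x∉vc) (here refl) refl ; (there c∈v) → c∉v c∈v }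

swapAt-involutive : ∀ i v → swapAt i (swapAt i v) ≡ v
swapAt-involutive zero          v           = refl
swapAt-involutive (suc zero)    []          = refl
swapAt-involutive (suc zero)    (x ∷ [])    = refl
swapAt-involutive (suc zero)    (x ∷ y ∷ v) = refl
swapAt-involutive (suc (suc i)) []          = refl
swapAt-involutive (suc (suc i)) (x ∷ v)     = cong (x ∷_) (swapAt-involutive (suc i) v)

swapAt-comm : ∀ i k v → 2 ≤ ∣ i - k ∣ → swapAt i (swapAt k v) ≡ swapAt k (swapAt i v)
swapAt-comm zero                k                   v           _  = refl
swapAt-comm (suc i)             zero                v           _  = refl
swapAt-comm (suc zero)          (suc zero)          v           ()
swapAt-comm (suc zero)          (suc (suc zero))    v           (s≤s ())
swapAt-comm (suc (suc zero))    (suc zero)          v           (s≤s ())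
swapAt-comm (suc zero)          (suc (suc (suc k))) []          _  = refl
swapAt-comm (suc zero)          (suc (suc (suc k))) (x ∷ [])    _  = refl
swapAt-comm (suc zero)          (suc (suc (suc k))) (x ∷ y ∷ v) _  = refl
swapAt-comm (suc (suc (suc i))) (suc zero)          []          _  = refl
swapAt-comm (suc (suc (suc i))) (suc zero)          (x ∷ [])    _  = refl
swapAt-comm (suc (suc (suc i))) (suc zero)          (x ∷ y ∷ v) _  = refl
swapAt-comm (suc (suc i))       (suc (suc k))       []          _  = refl
swapAt-comm (suc (suc i))       (suc (suc k))       (x ∷ v)     h  = cong (x ∷_) (swapAt-comm (suc i) (suc k) v h)

∈-swapAt⁺ : ∀ {x} i v → x ∈ v → x ∈ swapAt i v
∈-swapAt⁺ zero          v           x∈                 = x∈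
∈-swapAt⁺ (suc zero)    (a ∷ [])    x∈                 = x∈
∈-swapAt⁺ (suc zero)    (a ∷ b ∷ v) (here x≡a)         = there (here x≡a)
∈-swapAt⁺ (suc zero)    (a ∷ b ∷ v) (there (here x≡b)) = here x≡b
∈-swapAt⁺ (suc zero)    (a ∷ b ∷ v) (there (there x∈)) = there (there x∈)
∈-swapAt⁺ (suc (suc i)) (a ∷ v)     (here x≡a)         = here x≡a
∈-swapAt⁺ (suc (suc i)) (a ∷ v)     (there x∈)         = there (∈-swapAt⁺ (suc i) v x∈)

∈-swapAt⁻ : ∀ {x} i v → x ∈ swapAt i v → x ∈ v
∈-swapAt⁻ i v x∈ = subst (_ ∈_) (swapAt-involutive i v) (∈-swapAt⁺ i (swapAt i v) x∈)

swapAt-unique : ∀ i v → Unique v → Unique (swapAt i v)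
swapAt-unique zero          v           v!                           = v!
swapAt-unique (suc zero)    []          v!                           = v!
swapAt-unique (suc zero)    (a ∷ [])    v!                           = v!
swapAt-unique (suc zero)    (a ∷ b ∷ v) ((a≢b ∷ a∉v) ∷ b∉v ∷ v!)     = ((λ b≡a → a≢b (sym b≡a)) ∷ b∉v) ∷ a∉v ∷ v!
swapAt-unique (suc (suc i)) []          v!                           = v!
swapAt-unique (suc (suc i)) (a ∷ v)     (a∉v ∷ v!)                   =
  All.tabulate (λ x∈ → All.lookup a∉v (∈-swapAt⁻ (suc i) v x∈)) ∷ swapAt-unique (suc i) v v!

swapAt-isPerm : ∀ {n} i v → IsPerm n v → IsPerm n (swapAt i v)
swapAt-isPerm i v perm = record
  { unique  = swapAt-unique i v unique
  ; bounded = λ x∈ → bounded (∈-swapAt⁻ i v x∈)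
  ; onto    = λ 1≤x x≤n → ∈-swapAt⁺ i v (onto 1≤x x≤n)
  }
  where open IsPerm perm

swapAt-length : ∀ i v → length (swapAt i v) ≡ length v
swapAt-length zero          v           = refl
swapAt-length (suc zero)    []          = refl
swapAt-length (suc zero)    (a ∷ [])    = refl
swapAt-length (suc zero)    (a ∷ b ∷ v) = refl
swapAt-length (suc (suc i)) []          = refl
swapAt-length (suc (suc i)) (a ∷ v)     = cong suc (swapAt-length (suc i) v)

swapAt-map : ∀ (f : ℕ → ℕ) i v → swapAt i (map f v) ≡ map f (swapAt i v)
swapAt-map f zero          v           = refl
swapAt-map f (suc zero)    []          = refl
swapAt-map f (suc zero)    (a ∷ [])    = refl
swapAt-map f (suc zero)    (a ∷ b ∷ v) = refl
swapAt-map f (suc (suc i)) []          = refl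
swapAt-map f (suc (suc i)) (a ∷ v)     = cong (f a ∷_) (swapAt-map f (suc i) v)

swapAt-∷ʳ : ∀ i v (x : ℕ) → i < length v → swapAt i (v ∷ʳ x) ≡ swapAt i v ∷ʳ x
swapAt-∷ʳ zero          v           x _         = refl
swapAt-∷ʳ (suc zero)    (a ∷ b ∷ v) x _         = refl
swapAt-∷ʳ (suc zero)    (a ∷ [])    x (s≤s ())
swapAt-∷ʳ (suc (suc i)) (a ∷ v)     x (s≤s i<∣v∣) = cong (a ∷_) (swapAt-∷ʳ (suc i) v x i<∣v∣)

act : OneLine → Word → OneLine
act v p = foldl (λ w i → swapAt i w) v p

act-++ : ∀ v p q → act v (p ++ q) ≡ act (act v p) q
act-++ v p q = foldl-++ (λ w i → swapAt i w) v p q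

act-map : ∀ (f : ℕ → ℕ) v p → act (map f v) p ≡ map f (act v p)
act-map f v []      = refl
act-map f v (i ∷ p) = trans (cong (λ u → act u p) (swapAt-map f i v)) (act-map f (swapAt i v) p)

act-∷ʳ : ∀ v (x : ℕ) p → All (_< length v) p → act (v ∷ʳ x) p ≡ act v p ∷ʳ x
act-∷ʳ v x []      []             = refl
act-∷ʳ v x (i ∷ p) (i<∣v∣ ∷ p<∣v∣) =
  trans (cong (λ u → act u p) (swapAt-∷ʳ i v x i<∣v∣))
        (act-∷ʳ (swapAt i v) x p (All.map (subst (_ <_) (sym (swapAt-length i v))) p<∣v∣))

act-∷ : ∀ (y : ℕ) v p → All (1 ≤_) p → act (y ∷ v) (map suc p) ≡ y ∷ act v p
act-∷ y v []          []        = refl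
act-∷ y v (suc i ∷ p) (_ ∷ 1≤p) = act-∷ y (swapAt (suc i) v) p 1≤p

act-isPerm : ∀ {n} v p → IsPerm n v → IsPerm n (act v p)
act-isPerm v []      perm = perm
act-isPerm v (i ∷ p) perm = act-isPerm (swapAt i v) p (swapAt-isPerm i v perm)

idPerm-length : ∀ n → length (idPerm n) ≡ n
idPerm-length n = trans (length-map suc (upTo n)) (length-upTo n)

idPerm-∷ʳ : ∀ n → idPerm (suc n) ≡ idPerm n ∷ʳ suc n
idPerm-∷ʳ n = trans (cong (map suc) (sym (upTo-∷ʳ n))) (map-++ suc (upTo n) [ n ])

idPerm-∷ : ∀ n → idPerm (suc n) ≡ 1 ∷ map suc (idPerm n)
idPerm-∷ n = cong (λ xs → 1 ∷ map suc xs) (sym (map-applyUpTo id suc n))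

idPerm-increasing : ∀ n → AllPairs _<_ (idPerm n)
idPerm-increasing n = AllPairs.map⁺ (AllPairs.applyUpTo⁺₁ id n (λ i<j _ → s≤s i<j))

idPerm-isPerm : ∀ n → IsPerm n (idPerm n)
idPerm-isPerm n = record
  { unique  = Unique.map⁺ suc-injective (Unique.upTo⁺ n)
  ; bounded = bounded
  ; onto    = onto
  }
  where
  bounded : ∀ {x} → x ∈ idPerm n → InRange n x
  bounded x∈ with _ , i∈ , refl ← ∈-map⁻ suc x∈ = s≤s z≤n , ∈-upTo⁻ i∈
  onto : ∀ {x} → 1 ≤ x → x ≤ n → x ∈ idPerm n
  onto {suc i} _ i<n = ∈-map⁺ suc (∈-upTo⁺ i<n)

ascending : ℕ → Word
ascending zero    = []
ascending (suc k) = 1 ∷ map suc (ascending k)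

ascending-∷ʳ : ∀ k → ascending (suc k) ≡ ascending k ∷ʳ suc k
ascending-∷ʳ zero    = refl
ascending-∷ʳ (suc k) = cong (1 ∷_) (trans (cong (map suc) (ascending-∷ʳ k)) (map-++ suc (ascending k) [ suc k ]))

ascending-positive : ∀ k → All (1 ≤_) (ascending k)
ascending-positive zero    = []
ascending-positive (suc k) = s≤s z≤n ∷ All.map⁺ (All.universal (λ _ → s≤s z≤n) (ascending k))

act-ascending : ∀ (x : ℕ) ys zs → act (x ∷ ys ++ zs) (ascending (length ys)) ≡ ys ++ x ∷ zs
act-ascending x []       zs = refl
act-ascending x (y ∷ ys) zs =
  trans (act-∷ y (x ∷ ys ++ zs) (ascending (length ys)) (ascending-positive (length ys)))
        (cong (y ∷_) (act-ascending x ys zs))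

++-split : ∀ (p q xs ys : List ℕ) → p ++ q ≡ xs ++ ys →
           (Σ (List ℕ) λ r → xs ≡ p ++ r) ⊎ (Σ (List ℕ) λ p′ → p ≡ xs ++ p′ × ys ≡ p′ ++ q)
++-split []      q xs       ys eq = inj₁ (xs , refl)
++-split (a ∷ p) q []       ys eq = inj₂ (a ∷ p , refl , sym eq)
++-split (a ∷ p) q (b ∷ xs) ys eq with refl , eq′ ← ∷-injective eq with ++-split p q xs ys eq′
... | inj₁ (r , refl)         = inj₁ (r , refl)
... | inj₂ (p′ , refl , refl) = inj₂ (p′ , refl , refl)

prefix-ascending : ∀ k p r → p ++ r ≡ ascending k → Σ ℕ λ j → j ≤ k × p ≡ ascending j
prefix-ascending zero    []      r eq = 0 , z≤n , refl
prefix-ascending (suc k) p       r eq with ++-split p r (ascending k) [ suc k ] (trans eq (ascending-∷ʳ k))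
... | inj₁ (r′ , eq′) with j , j≤k , refl ← prefix-ascending k p r′ (sym eq′) = j , m≤n⇒m≤1+n j≤k , refl
... | inj₂ ([]    , refl , _)     = k , n≤1+n k , ++-identityʳ (ascending k)
... | inj₂ (_ ∷ [] , refl , refl) = suc k , ≤-refl , sym (ascending-∷ʳ k)

-- Permutations avoiding 132 and 312

extendTop : ℕ → OneLine → OneLine
extendTop n w = w ∷ʳ suc n

extendBottom : OneLine → OneLine
extendBottom w = map suc w ∷ʳ 1

-- x and z both precede y, where x < y < z: an occurrence of 132 or of 312.
Avoids-132-312 : OneLine → Set
Avoids-132-312 w = ∀ {x y z} → x < y → y < z → Precedes w x y → Precedes w z y → ⊥

avoids-∷ʳ⁻ : ∀ v c → Avoids-132-312 (v ∷ʳ c) → Avoids-132-312 v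
avoids-∷ʳ⁻ v c avoids x<y y<z p q = avoids x<y y<z (Precedes-++ʳ [ c ] p) (Precedes-++ʳ [ c ] q)

avoids-map-suc⁻ : ∀ v → Avoids-132-312 (map suc v) → Avoids-132-312 v
avoids-map-suc⁻ v avoids x<y y<z p q = avoids (s≤s x<y) (s≤s y<z) (Precedes-map-suc⁺ p) (Precedes-map-suc⁺ q)

avoids-extendBottom : ∀ v → Avoids-132-312 v → Avoids-132-312 (extendBottom v)
avoids-extendBottom v avoids {suc x} {suc (suc y)} {suc z} (s≤s x<y) (s≤s y<z) p q =
  avoids x<y y<z (Precedes-map-suc⁻ (Precedes-∷ʳ⁻ (map suc v) 1 (λ ()) p))
                 (Precedes-map-suc⁻ (Precedes-∷ʳ⁻ (map suc v) 1 (λ ()) q))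
avoids-extendBottom v avoids {zero} _ _ p _ with Precedes-∷ʳ⁻ˡ (map suc v) 1 p
... | 0∈ with _ , _ , () ← ∈-map⁻ suc 0∈
avoids-extendBottom v avoids {suc x} {suc zero} (s≤s ()) _ _ _

-- Deleting the 1 leaves an increasing list, so only y = 1 could follow a larger z; but no x < 1 occurs.
avoids-insert-1 : ∀ ys zs → AllPairs _<_ (ys ++ zs) → 0 ∉ ys ++ zs → Avoids-132-312 (ys ++ 1 ∷ zs)
avoids-insert-1 ys zs increasing 0∉ {zero} {suc zero} _ _ p _ with ∈-++⁻ ys (Precedes⇒∈ˡ p)
... | inj₁ 0∈ys           = 0∉ (∈-++⁺ˡ 0∈ys)
... | inj₂ (there 0∈zs)   = 0∉ (∈-++⁺ʳ ys 0∈zs)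
avoids-insert-1 ys zs increasing 0∉ {suc x} {suc zero} (s≤s ()) _ _ _
avoids-insert-1 ys zs increasing 0∉ {y = suc (suc y)} {suc zero} _ (s≤s ()) _ _
avoids-insert-1 ys zs increasing 0∉ {y = suc (suc y)} {suc (suc z)} _ y<z _ q =
  <-asym y<z (Precedes-AllPairs increasing (Precedes-remove ys 1 zs (λ ()) (λ ()) q))

isPerm-extendTop : ∀ {n v} → IsPerm n v → IsPerm (suc n) (extendTop n v)
isPerm-extendTop {n} {v} perm = record
  { unique  = unique-∷ʳ⁺ unique (λ n+1∈ → 1+n≰n (proj₂ (bounded n+1∈)))
  ; bounded = bounded′
  ; onto    = onto′
  }
  where
  open IsPerm perm
  bounded′ : ∀ {x} → x ∈ extendTop n v → InRange (suc n) x
  bounded′ x∈ with ∈-++⁻ v x∈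
  ... | inj₁ x∈v        = proj₁ (bounded x∈v) , m≤n⇒m≤1+n (proj₂ (bounded x∈v))
  ... | inj₂ (here refl) = s≤s z≤n , ≤-refl
  onto′ : ∀ {x} → 1 ≤ x → x ≤ suc n → x ∈ extendTop n v
  onto′ 1≤x x≤1+n with m≤n⇒m<n∨m≡n x≤1+n
  ... | inj₁ (s≤s x≤n) = ∈-++⁺ˡ (onto 1≤x x≤n)
  ... | inj₂ refl      = ∈-++⁺ʳ v (here refl)

isPerm-extendBottom : ∀ {n v} → IsPerm n v → IsPerm (suc n) (extendBottom v)
isPerm-extendBottom {n} {v} perm = record
  { unique  = unique-∷ʳ⁺ (Unique.map⁺ suc-injective unique) 1∉
  ; bounded = bounded′
  ; onto    = onto′
  }
  where
  open IsPerm perm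
  1∉ : 1 ∉ map suc v
  1∉ 1∈ with _ , 0∈ , refl ← ∈-map⁻ suc 1∈ = 1+n≰n (proj₁ (bounded 0∈))
  bounded′ : ∀ {x} → x ∈ extendBottom v → InRange (suc n) x
  bounded′ x∈ with ∈-++⁻ (map suc v) x∈
  ... | inj₁ x∈sv with _ , y∈ , refl ← ∈-map⁻ suc x∈sv = s≤s z≤n , s≤s (proj₂ (bounded y∈))
  bounded′ x∈ | inj₂ (here refl) = s≤s z≤n , s≤s z≤n
  onto′ : ∀ {x} → 1 ≤ x → x ≤ suc n → x ∈ extendBottom v
  onto′ {suc zero}    _ _         = ∈-++⁺ʳ (map suc v) (here refl)
  onto′ {suc (suc x)} _ (s≤s x<n) = ∈-++⁺ˡ (∈-map⁺ suc (onto (s≤s z≤n) x<n))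

isPerm-extendTop⁻ : ∀ {n v} → IsPerm (suc n) (extendTop n v) → IsPerm n v
isPerm-extendTop⁻ {n} {v} perm = record
  { unique  = proj₁ (unique-∷ʳ⁻ v unique)
  ; bounded = bounded′
  ; onto    = λ 1≤x x≤n → last-excluded (onto 1≤x (m≤n⇒m≤1+n x≤n)) (<⇒≢ (s≤s x≤n))
  }
  where
  open IsPerm perm
  last-excluded : ∀ {x} → x ∈ extendTop n v → x ≢ suc n → x ∈ v
  last-excluded x∈ x≢ with ∈-++⁻ v x∈
  ... | inj₁ x∈v         = x∈v
  ... | inj₂ (here refl) = ⊥-elim (x≢ refl)
  bounded′ : ∀ {x} → x ∈ v → InRange n x
  bounded′ x∈ with 1≤x , x≤1+n ← bounded (∈-++⁺ˡ x∈) =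
    1≤x , ≤-pred (≤∧≢⇒< x≤1+n λ { refl → proj₂ (unique-∷ʳ⁻ v unique) x∈ })

isPerm-∷ʳ-1⁻ : ∀ {n v} → IsPerm (suc n) (v ∷ʳ 1) → Σ OneLine λ v′ → v ≡ map suc v′ × IsPerm n v′
isPerm-∷ʳ-1⁻ {n} {v} perm = map pred v , shift , record
  { unique  = Unique.map⁻ (subst Unique shift v!)
  ; bounded = bounded′
  ; onto    = onto′
  }
  where
  open IsPerm perm
  v! : Unique v
  v! = proj₁ (unique-∷ʳ⁻ v unique)
  1∉v : 1 ∉ v
  1∉v = proj₂ (unique-∷ʳ⁻ v unique)
  2≤ : ∀ {x} → x ∈ v → 2 ≤ x
  2≤ x∈ = ≤∧≢⇒< (proj₁ (bounded (∈-++⁺ˡ x∈))) λ { refl → 1∉v x∈ }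
  shift : v ≡ map suc (map pred v)
  shift = sym (map-suc-pred v (All.tabulate λ x∈ → <⇒≤ (2≤ x∈)))
    where
    map-suc-pred : ∀ u → All (1 ≤_) u → map suc (map pred u) ≡ u
    map-suc-pred []      []            = refl
    map-suc-pred (suc x ∷ u) (_ ∷ 1≤u) = cong (suc x ∷_) (map-suc-pred u 1≤u)
  bounded′ : ∀ {x} → x ∈ map pred v → InRange n x
  bounded′ x∈ with y , y∈ , refl ← ∈-map⁻ pred x∈ with 2≤ y∈ | proj₂ (bounded (∈-++⁺ˡ y∈))
  ... | s≤s 1≤y | s≤s y≤n = 1≤y , y≤n
  onto′ : ∀ {x} → 1 ≤ x → x ≤ n → x ∈ map pred v
  onto′ {x} 1≤x x≤n with ∈-++⁻ v (onto (s≤s z≤n) (s≤s x≤n))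
  ... | inj₁ x+1∈v = ∈-map⁺ pred x+1∈v
  ... | inj₂ (here x+1≡1) = ⊥-elim (<⇒≢ (s≤s 1≤x) (sym x+1≡1))

avoiders : ℕ → List OneLine
avoiders zero          = [ [] ]
avoiders (suc zero)    = [ [ 1 ] ]
avoiders (suc (suc m)) = map (extendTop (suc m)) (avoiders (suc m)) ++ map extendBottom (avoiders (suc m))

avoiders-isPerm : ∀ m {w} → w ∈ avoiders (suc m) → IsPerm (suc m) w
avoiders-isPerm zero (here refl) = idPerm-isPerm 1
avoiders-isPerm (suc m) w∈ with ∈-++⁻ (map (extendTop (suc m)) (avoiders (suc m))) w∈
... | inj₁ w∈top with _ , v∈ , refl ← ∈-map⁻ (extendTop (suc m)) w∈top = isPerm-extendTop (avoiders-isPerm m v∈)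
... | inj₂ w∈bot with _ , v∈ , refl ← ∈-map⁻ extendBottom w∈bot = isPerm-extendBottom (avoiders-isPerm m v∈)

avoiders-unique : ∀ m → Unique (avoiders (suc m))
avoiders-unique zero    = [] ∷ []
avoiders-unique (suc m) =
  Unique.++⁺ (Unique.map⁺ (∷ʳ-injectiveˡ _ _) (avoiders-unique m))
             (Unique.map⁺ (λ eq → map-injective suc-injective (∷ʳ-injectiveˡ _ _ eq)) (avoiders-unique m))
             top≢bottom
  where
  top≢bottom : ∀ {w} → w ∈ map (extendTop (suc m)) (avoiders (suc m)) × w ∈ map extendBottom (avoiders (suc m)) → ⊥
  top≢bottom (w∈top , w∈bot) with v , _ , refl ← ∈-map⁻ (extendTop (suc m)) w∈top
                             with v′ , _ , eq ← ∈-map⁻ extendBottom w∈bot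
                             with () ← ∷ʳ-injectiveʳ v (map suc v′) eq

avoiders-nonempty : ∀ m → 1 ≤ length (avoiders (suc m))
avoiders-nonempty zero    = s≤s z≤n
avoiders-nonempty (suc m) = begin
  1                                                         ≤⟨ avoiders-nonempty m ⟩
  length G                                                  ≡⟨ length-map (extendTop (suc m)) G ⟨
  length (map (extendTop (suc m)) G)                        ≤⟨ m≤m+n _ _ ⟩
  length (map (extendTop (suc m)) G) + length (map extendBottom G)
                                                            ≡⟨ length-++ (map (extendTop (suc m)) G) ⟨
  length (avoiders (suc (suc m)))                           ∎
  where
  open ≤-Reasoning
  G : List OneLine
  G = avoiders (suc m)

last-extreme : ∀ {n v ℓ} → IsPerm (suc n) (v ∷ʳ ℓ) → Avoids-132-312 (v ∷ʳ ℓ) → ℓ ≡ 1 ⊎ ℓ ≡ suc n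
last-extreme {n} {v} {ℓ} perm avoids with ℓ ≟ 1 | ℓ ≟ suc n
... | yes ℓ≡1 | _       = inj₁ ℓ≡1
... | no _    | yes ℓ≡n = inj₂ ℓ≡n
... | no ℓ≢1  | no ℓ≢n  = ⊥-elim (avoids 1<ℓ ℓ<n (Precedes-∷ʳ-last v ℓ 1∈v) (Precedes-∷ʳ-last v ℓ n∈v))
  where
  open IsPerm perm
  1<ℓ : 1 < ℓ
  1<ℓ = ≤∧≢⇒< (proj₁ (bounded (∈-++⁺ʳ v (here refl)))) (ℓ≢1 ∘ sym)
  ℓ<n : ℓ < suc n
  ℓ<n = ≤∧≢⇒< (proj₂ (bounded (∈-++⁺ʳ v (here refl)))) ℓ≢n
  in-v : ∀ x → 1 ≤ x → x ≤ suc n → x ≢ ℓ → x ∈ v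
  in-v x 1≤x x≤n x≢ℓ with ∈-++⁻ v (onto 1≤x x≤n)
  ... | inj₁ x∈v         = x∈v
  ... | inj₂ (here refl) = ⊥-elim (x≢ℓ refl)
  1∈v : 1 ∈ v
  1∈v = in-v 1 (s≤s z≤n) (s≤s z≤n) (ℓ≢1 ∘ sym)
  n∈v : suc n ∈ v
  n∈v = in-v (suc n) (s≤s z≤n) ≤-refl (ℓ≢n ∘ sym)

isPerm-1 : ∀ {w} → IsPerm 1 w → w ≡ [ 1 ]
isPerm-1 {[]}        perm with () ← IsPerm.onto perm (s≤s z≤n) (s≤s z≤n)
isPerm-1 {_ ∷ []}    perm with s≤s z≤n , s≤s z≤n ← IsPerm.bounded perm (here refl) = refl
isPerm-1 {_ ∷ _ ∷ _} perm with s≤s z≤n , s≤s z≤n ← IsPerm.bounded perm (here refl)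
                             | s≤s z≤n , s≤s z≤n ← IsPerm.bounded perm (there (here refl))
                             | (1≢1 ∷ _) ∷ _     ← IsPerm.unique perm
  = ⊥-elim (1≢1 refl)

avoiders-complete : ∀ m {w} → IsPerm (suc m) w → Avoids-132-312 w → w ∈ avoiders (suc m)
avoiders-complete zero perm _ rewrite isPerm-1 perm = here refl
avoiders-complete (suc m) {w} perm avoids with initLast w
... | [] with () ← IsPerm.onto perm {1} (s≤s z≤n) (s≤s z≤n)
... | v ∷ʳ′ ℓ with last-extreme perm avoids
...   | inj₂ refl = ∈-++⁺ˡ (∈-map⁺ (extendTop (suc m))
                    (avoiders-complete m (isPerm-extendTop⁻ perm) (avoids-∷ʳ⁻ v ℓ avoids)))
...   | inj₁ refl with v′ , refl , perm′ ← isPerm-∷ʳ-1⁻ perm =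
                    ∈-++⁺ʳ _ (∈-map⁺ extendBottom
                    (avoiders-complete m perm′ (avoids-map-suc⁻ v′ (avoids-∷ʳ⁻ (map suc v′) 1 avoids))))

-- The prefixes of the commutation class of m

CommStep-sym : ∀ {u v} → CommStep u v → CommStep v u
CommStep-sym (comm xs ys i j far) = comm xs ys j i (subst (2 ≤_) (∣-∣-comm i j) far)

CommStep-++ˡ : ∀ pre {u v} → CommStep u v → CommStep (pre ++ u) (pre ++ v)
CommStep-++ˡ pre (comm xs ys i j far) =
  subst₂ CommStep (++-assoc pre xs _) (++-assoc pre xs _) (comm (pre ++ xs) ys i j far)

CommStep-++ʳ : ∀ post {u v} → CommStep u v → CommStep (u ++ post) (v ++ post)
CommStep-++ʳ post (comm xs ys i j far) =
  subst₂ CommStep (sym (++-assoc xs _ post)) (sym (++-assoc xs _ post)) (comm xs (ys ++ post) i j far)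

CommStep-All : ∀ {P : ℕ → Set} {u v} → CommStep u v → All P u → All P v
CommStep-All (comm xs ys i j _) Pu with Pxs , Pi ∷ Pj ∷ Pys ← All.++⁻ xs Pu = All.++⁺ Pxs (Pj ∷ Pi ∷ Pys)

act-CommStep : ∀ w {u v} → CommStep u v → act w u ≡ act w v
act-CommStep w (comm xs ys i j far) = begin
  act w (xs ++ i ∷ j ∷ ys)                          ≡⟨ act-++ w xs _ ⟩
  act (swapAt j (swapAt i (act w xs))) ys
    ≡⟨ cong (λ u → act u ys) (swapAt-comm j i _ (subst (2 ≤_) (∣-∣-comm i j) far)) ⟩
  act (swapAt i (swapAt j (act w xs))) ys            ≡⟨ act-++ w xs _ ⟨
  act w (xs ++ j ∷ i ∷ ys)                          ∎
  where open ≡-Reasoning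

commClass-sym : ∀ {u v} → InCommClass u v → InCommClass v u
commClass-sym = Star.reverse CommStep-sym

commClass-++ˡ : ∀ pre {u v} → InCommClass u v → InCommClass (pre ++ u) (pre ++ v)
commClass-++ˡ pre = Star.gmap (pre ++_) (CommStep-++ˡ pre)

commClass-++ʳ : ∀ post {u v} → InCommClass u v → InCommClass (u ++ post) (v ++ post)
commClass-++ʳ post = Star.gmap (_++ post) (CommStep-++ʳ post)

commClass-All : ∀ {P : ℕ → Set} {u v} → InCommClass u v → All P u → All P v
commClass-All ε        Pu = Pu
commClass-All (s ◅ ss) Pu = commClass-All ss (CommStep-All s Pu)

commClass-past : ∀ (c : ℕ) xs post → All (λ x → 2 ≤ ∣ x - c ∣) xs → InCommClass (xs ++ c ∷ post) (c ∷ xs ++ post)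
commClass-past c []       post []           = ε
commClass-past c (x ∷ xs) post (far ∷ fars) =
  commClass-++ˡ [ x ] (commClass-past c xs post fars) ◅◅ comm [] (xs ++ post) x c far ◅ ε

desc-bounded : ∀ k → All (_≤ k) (desc k)
desc-bounded zero    = []
desc-bounded (suc k) = ≤-refl ∷ All.map m≤n⇒m≤1+n (desc-bounded k)

mWord-bounded : ∀ k → All (_≤ k) (mWord (suc k))
mWord-bounded zero    = []
mWord-bounded (suc k) = All.++⁺ (All.map m≤n⇒m≤1+n (mWord-bounded k)) (desc-bounded (suc k))

far-apart : ∀ {x n} → x ≤ n → 2 ≤ ∣ x - suc (suc n) ∣
far-apart {zero}  _         = s≤s (s≤s z≤n)
far-apart {suc x} (s≤s x≤n) = far-apart x≤n

-- The leading letter k of each block (k, …, 1) of m commutes left past all earlier blocks,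
-- whose letters are at most k - 2.
mWord-commClass-ascending : ∀ n → InCommClass (mWord (suc n)) (ascending n ++ mWord n)
mWord-commClass-ascending zero    = ε
mWord-commClass-ascending (suc n) =
  commClass-++ʳ (desc (suc n)) (mWord-commClass-ascending n)
  ◅◅ subst₂ InCommClass (sym (++-assoc (ascending n) (mWord n) _)) regroup
       (commClass-++ˡ (ascending n) (commClass-past (suc n) (mWord n) (desc n) (far n)))
  where
  far : ∀ n → All (λ x → 2 ≤ ∣ x - suc n ∣) (mWord n)
  far zero    = []
  far (suc m) = All.map far-apart (mWord-bounded m)
  regroup : ascending n ++ suc n ∷ mWord n ++ desc n ≡ ascending (suc n) ++ mWord (suc n)
  regroup = trans (sym (++-assoc (ascending n) [ suc n ] _)) (cong (_++ mWord (suc n)) (sym (ascending-∷ʳ n)))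

prefix-bounded : ∀ m {p q} → InCommClass (mWord (suc m)) (p ++ q) → All (_≤ m) p
prefix-bounded m {p} m~pq = All.++⁻ˡ p (commClass-All m~pq (mWord-bounded m))

evalWord-extendTop : ∀ m p → All (_≤ m) p → evalWord (suc (suc m)) p ≡ extendTop (suc m) (evalWord (suc m) p)
evalWord-extendTop m p p≤m =
  trans (cong (λ v → act v p) (idPerm-∷ʳ (suc m)))
        (act-∷ʳ (idPerm (suc m)) (suc (suc m)) p
          (All.map (λ {i} i≤m → subst (i <_) (sym (idPerm-length (suc m))) (s≤s i≤m)) p≤m))

length-map-suc-idPerm : ∀ n → length (map suc (idPerm n)) ≡ n
length-map-suc-idPerm n = trans (length-map suc (idPerm n)) (idPerm-length n)

evalWord-ascending : ∀ m ys zs → ys ++ zs ≡ map suc (idPerm (suc m)) →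
  evalWord (suc (suc m)) (ascending (length ys)) ≡ ys ++ 1 ∷ zs
evalWord-ascending m ys zs ys++zs =
  trans (cong (λ v → act v (ascending (length ys))) (trans (idPerm-∷ (suc m)) (cong (1 ∷_) (sym ys++zs))))
        (act-ascending 1 ys zs)

evalWord-extendBottom : ∀ m p → All (_≤ m) p →
  evalWord (suc (suc m)) (ascending (suc m) ++ p) ≡ extendBottom (evalWord (suc m) p)
evalWord-extendBottom m p p≤m = begin
  evalWord (suc (suc m)) (ascending (suc m) ++ p)   ≡⟨ act-++ (idPerm (suc (suc m))) (ascending (suc m)) p ⟩
  act (evalWord (suc (suc m)) (ascending (suc m))) p ≡⟨ cong (λ v → act v p) moved ⟩
  act (ys ∷ʳ 1) p
    ≡⟨ act-∷ʳ ys 1 p (All.map (λ {i} i≤m → subst (i <_) (sym (length-map-suc-idPerm (suc m))) (s≤s i≤m)) p≤m) ⟩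
  act ys p ∷ʳ 1                                     ≡⟨ cong (_∷ʳ 1) (act-map suc (idPerm (suc m)) p) ⟩
  extendBottom (evalWord (suc m) p)                 ∎
  where
  open ≡-Reasoning
  ys : OneLine
  ys = map suc (idPerm (suc m))
  moved : evalWord (suc (suc m)) (ascending (suc m)) ≡ ys ∷ʳ 1
  moved = subst (λ k → evalWord (suc (suc m)) (ascending k) ≡ ys ∷ʳ 1) (length-map-suc-idPerm (suc m))
                (evalWord-ascending m ys [] (++-identityʳ ys))

avoiders⊆Pre : ∀ m {w} → w ∈ avoiders (suc m) → InPre (suc m) (mWord (suc m)) w
avoiders⊆Pre zero    (here refl) = [] , ε , [] , [] , refl , refl
avoiders⊆Pre (suc m) w∈ with ∈-++⁻ (map (extendTop (suc m)) (avoiders (suc m))) w∈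
... | inj₁ w∈top with _ , v∈ , refl ← ∈-map⁻ (extendTop (suc m)) w∈top
                 with j , m~j , p , q , refl , refl ← avoiders⊆Pre m v∈ =
  j ++ desc (suc m) , commClass-++ʳ (desc (suc m)) m~j , p , q ++ desc (suc m) , ++-assoc p q _ ,
  evalWord-extendTop m p (prefix-bounded m m~j)
... | inj₂ w∈bot with _ , v∈ , refl ← ∈-map⁻ extendBottom w∈bot
                 with j , m~j , p , q , refl , refl ← avoiders⊆Pre m v∈ =
  ascending (suc m) ++ j , mWord-commClass-ascending (suc m) ◅◅ commClass-++ˡ (ascending (suc m)) m~j ,
  ascending (suc m) ++ p , q , sym (++-assoc (ascending (suc m)) p q) ,
  evalWord-extendBottom m p (prefix-bounded m m~j)

data Adjacent : ℕ → OneLine → ℕ → ℕ → Set where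
  first : ∀ {x y zs} → Adjacent 1 (x ∷ y ∷ zs) x y
  next  : ∀ {i z xs x y} → Adjacent (suc i) xs x y → Adjacent (suc (suc i)) (z ∷ xs) x y

Precedes-swapAt : ∀ i v {x y} → Precedes v x y → Precedes (swapAt i v) x y ⊎ Adjacent i v x y
Precedes-swapAt zero          v           p                = inj₁ p
Precedes-swapAt (suc zero)    (a ∷ [])    p                = inj₁ p
Precedes-swapAt (suc zero)    (a ∷ c ∷ v) (now (here refl)) = inj₂ first
Precedes-swapAt (suc zero)    (a ∷ c ∷ v) (now (there y∈))  = inj₁ (later (now y∈))
Precedes-swapAt (suc zero)    (a ∷ c ∷ v) (later (now y∈))  = inj₁ (now (there y∈))
Precedes-swapAt (suc zero)    (a ∷ c ∷ v) (later (later p)) = inj₁ (later (later p))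
Precedes-swapAt (suc (suc i)) (a ∷ v)     (now y∈)          = inj₁ (now (∈-swapAt⁺ (suc i) v y∈))
Precedes-swapAt (suc (suc i)) (a ∷ v)     (later p) with Precedes-swapAt (suc i) v p
... | inj₁ p′  = inj₁ (later p′)
... | inj₂ adj = inj₂ (next adj)

Adjacent⇒∈ : ∀ {i c v x y} → Adjacent i (c ∷ v) x y → y ∈ v
Adjacent⇒∈ first                = here refl
Adjacent⇒∈ {v = []}    (next ())
Adjacent⇒∈ {v = _ ∷ _} (next p) = there (Adjacent⇒∈ p)

Adjacent-position : ∀ {i k v x x′ y} → Unique v → Adjacent i v x y → Adjacent k v x′ y → i ≡ k
Adjacent-position _                first    first    = refl
Adjacent-position (_ ∷ (y∉ ∷ _))   first    (next q) = ⊥-elim (All.lookup y∉ (Adjacent⇒∈ q) refl)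
Adjacent-position (_ ∷ (y∉ ∷ _))   (next p) first    = ⊥-elim (All.lookup y∉ (Adjacent⇒∈ p) refl)
Adjacent-position (_ ∷ v!)         (next p) (next q) = cong suc (Adjacent-position v! p q)

-- A pattern in s_k E that is destroyed both by undoing s_k and by applying the commuting s_i
-- would need its last entry in positions k+1 and i+1 at once.
avoids-middle-swap : ∀ i k E → 2 ≤ ∣ i - k ∣ → Unique (swapAt k E) →
  Avoids-132-312 E → Avoids-132-312 (swapAt k (swapAt i E)) → Avoids-132-312 (swapAt k E)
avoids-middle-swap i k E far v! avoidsE avoidsT {x} {y} {z} x<y y<z p q =
  i≢k (Adjacent-position v! (proj₂ (ends i atI)) (proj₂ (ends k atK)))
  where
  v : OneLine
  v = swapAt k E
  atK : Avoids-132-312 (swapAt k v)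
  atK = subst Avoids-132-312 (sym (swapAt-involutive k E)) avoidsE
  atI : Avoids-132-312 (swapAt i v)
  atI = subst Avoids-132-312 (sym (swapAt-comm i k E far)) avoidsT
  ends : ∀ j → Avoids-132-312 (swapAt j v) → Σ ℕ λ x′ → Adjacent j v x′ y
  ends j avoids with Precedes-swapAt j v p | Precedes-swapAt j v q
  ... | inj₂ adj | _        = _ , adj
  ... | inj₁ _   | inj₂ adj = _ , adj
  ... | inj₁ p′  | inj₁ q′  = ⊥-elim (avoids x<y y<z p′ q′)
  i≢k : i ≢ k
  i≢k refl with () ← subst (2 ≤_) (∣n-n∣≡0 i) far

PrefixesAvoid : ℕ → Word → Set
PrefixesAvoid n j = ∀ p q → j ≡ p ++ q → Avoids-132-312 (evalWord n p)

prefixesAvoid-CommStep : ∀ n {u v} → CommStep u v → PrefixesAvoid n u → PrefixesAvoid n v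
prefixesAvoid-CommStep n (comm xs ys i k far) avoids p q eq with ++-split p q xs (k ∷ i ∷ ys) (sym eq)
... | inj₁ (r , refl) = avoids p (r ++ i ∷ k ∷ ys) (++-assoc p r _)
... | inj₂ ([] , refl , _) = avoids (xs ++ []) (i ∷ k ∷ ys) (sym (++-assoc xs [] _))
... | inj₂ (_ ∷ [] , refl , refl) =
  subst Avoids-132-312 (sym (act-++ (idPerm n) xs [ k ]))
    (avoids-middle-swap i k E far v!
      (subst Avoids-132-312 (act-++ (idPerm n) xs []) (avoids (xs ++ []) (i ∷ k ∷ ys) (sym (++-assoc xs [] _))))
      (subst Avoids-132-312 (act-++ (idPerm n) xs (i ∷ k ∷ []))
        (avoids (xs ++ i ∷ k ∷ []) ys (sym (++-assoc xs _ ys)))))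
  where
  E : OneLine
  E = evalWord n xs
  v! : Unique (swapAt k E)
  v! = subst Unique (act-++ (idPerm n) xs [ k ])
         (IsPerm.unique (act-isPerm (idPerm n) (xs ++ [ k ]) (idPerm-isPerm n)))
... | inj₂ (_ ∷ _ ∷ p″ , refl , refl) =
  subst Avoids-132-312 (act-CommStep (idPerm n) (comm xs p″ i k far))
    (avoids (xs ++ i ∷ k ∷ p″) q (sym (++-assoc xs _ q)))

prefixesAvoid-commClass : ∀ n {u v} → InCommClass u v → PrefixesAvoid n u → PrefixesAvoid n v
prefixesAvoid-commClass n ε        avoids = avoids
prefixesAvoid-commClass n (s ◅ ss) avoids = prefixesAvoid-commClass n ss (prefixesAvoid-CommStep n s avoids)

avoids-ascending-prefix : ∀ m j → j ≤ suc m → Avoids-132-312 (evalWord (suc (suc m)) (ascending j))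
avoids-ascending-prefix m j j≤ =
  subst (λ k → Avoids-132-312 (evalWord (suc (suc m)) (ascending k))) ∣ys∣
    (subst Avoids-132-312 (sym (evalWord-ascending m ys zs ys++zs)) (avoids-insert-1 ys zs increasing 0∉))
  where
  L ys zs : OneLine
  L  = map suc (idPerm (suc m))
  ys = take j L
  zs = drop j L
  ys++zs : ys ++ zs ≡ L
  ys++zs = take++drop≡id j L
  ∣ys∣ : length ys ≡ j
  ∣ys∣ = trans (length-take j L) (m≤n⇒m⊓n≡m (subst (j ≤_) (sym (length-map-suc-idPerm (suc m))) j≤))
  increasing : AllPairs _<_ (ys ++ zs)
  increasing = subst (AllPairs _<_) (sym ys++zs) (AllPairs.map⁺ (AllPairs.map s≤s (idPerm-increasing (suc m))))
  0∉ : 0 ∉ ys ++ zs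
  0∉ 0∈ with _ , _ , () ← ∈-map⁻ suc (subst (0 ∈_) ys++zs 0∈)

mWord-prefixesAvoid : ∀ m → PrefixesAvoid (suc m) (mWord (suc m))
mWord-prefixesAvoid zero [] [] refl _ _ (now ())   _
mWord-prefixesAvoid zero [] [] refl _ _ (later ()) _
mWord-prefixesAvoid (suc m) =
  prefixesAvoid-commClass (suc (suc m)) (commClass-sym (mWord-commClass-ascending (suc m))) split-avoids
  where
  split-avoids : PrefixesAvoid (suc (suc m)) (ascending (suc m) ++ mWord (suc m))
  split-avoids p q eq with ++-split p q (ascending (suc m)) (mWord (suc m)) (sym eq)
  ... | inj₁ (r , asc≡pr) with j , j≤ , refl ← prefix-ascending (suc m) p r (sym asc≡pr) =
    avoids-ascending-prefix m j j≤
  ... | inj₂ (p′ , refl , mWord≡p′q) =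
    subst Avoids-132-312
      (sym (evalWord-extendBottom m p′ (All.++⁻ˡ p′ (subst (All (_≤ m)) mWord≡p′q (mWord-bounded m)))))
      (avoids-extendBottom (evalWord (suc m) p′) (mWord-prefixesAvoid m p′ q mWord≡p′q))

Pre⊆avoiders : ∀ m {w} → InPre (suc m) (mWord (suc m)) w → w ∈ avoiders (suc m)
Pre⊆avoiders m (j , m~j , p , q , refl , refl) =
  avoiders-complete m (act-isPerm (idPerm (suc m)) p (idPerm-isPerm (suc m)))
                      (prefixesAvoid-commClass (suc m) m~j (mWord-prefixesAvoid m) p q refl)

-- Vote tallies

module _ {A : Set} where

  length-filter-cong : ∀ {P Q : A → Set} (P? : U.Decidable P) (Q? : U.Decidable Q) xs →
    (∀ {x} → x ∈ xs → P x ⇔ Q x) → length (filter P? xs) ≡ length (filter Q? xs)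
  length-filter-cong P? Q? []       _   = refl
  length-filter-cong P? Q? (x ∷ xs) P⇔Q with P? x | Q? x | length-filter-cong P? Q? xs (P⇔Q ∘ there)
  ... | yes _  | yes _  | rest = cong suc rest
  ... | no _   | no _   | rest = rest
  ... | yes p  | no ¬q  | _    = ⊥-elim (¬q (Equivalence.to (P⇔Q (here refl)) p))
  ... | no ¬p  | yes q  | _    = ⊥-elim (¬p (Equivalence.from (P⇔Q (here refl)) q))

  length-filter-map : ∀ {B : Set} {P : B → Set} (P? : U.Decidable P) (f : A → B) xs →
    length (filter P? (map f xs)) ≡ length (filter (P? ∘ f) xs)
  length-filter-map P? f []       = refl
  length-filter-map P? f (x ∷ xs) with does (P? (f x))
  ... | true  = cong suc (length-filter-map P? f xs)
  ... | false = length-filter-map P? f xs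

  length-filter-all : ∀ {P : A → Set} (P? : U.Decidable P) {xs} → (∀ {x} → x ∈ xs → P x) →
    length (filter P? xs) ≡ length xs
  length-filter-all P? all = cong length (filter-all P? (All.tabulate all))

  length-filter-none : ∀ {P : A → Set} (P? : U.Decidable P) {xs} → (∀ {x} → x ∈ xs → ¬ P x) →
    length (filter P? xs) ≡ 0
  length-filter-none P? none = cong length (filter-none P? (All.tabulate none))

tally : ℕ → ℕ → ℕ → ℕ
tally n a b = length (filter (λ w → precedes? w a b) (avoiders n))

tally-hasSize : ∀ m a b → HasSize (λ w → InPre (suc m) (mWord (suc m)) w × Before w a b) (tally (suc m) a b)
tally-hasSize m a b = filter P? (avoiders (suc m)) , Unique.filter⁺ P? (avoiders-unique m) , (λ w → mk⇔ to from) , refl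
  where
  P? : U.Decidable (λ w → Precedes w a b)
  P? w = precedes? w a b
  to : ∀ {w} → w ∈ filter P? (avoiders (suc m)) → InPre (suc m) (mWord (suc m)) w × Before w a b
  to w∈ with w∈′ , p ← ∈-filter⁻ P? w∈ = avoiders⊆Pre m w∈′ , Precedes⇒Before p
  from : ∀ {w} → InPre (suc m) (mWord (suc m)) w × Before w a b → w ∈ filter P? (avoiders (suc m))
  from (pre , before) = ∈-filter⁺ P? (Pre⊆avoiders m pre) (Before⇒Precedes before)

hasSize-unique : ∀ {P : OneLine → Set} {k l} → HasSize P k → HasSize P l → k ≡ l
hasSize-unique (xs , xs! , xs⇔P , refl) (ys , ys! , ys⇔P , refl) =
  ↭-length (∼bag⇒↭ (unique∧set⇒bag xs! ys! λ {w} → ⇔.trans (xs⇔P w) (⇔.sym (ys⇔P w))))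

tallyTop tallyBottom : ℕ → ℕ → ℕ → ℕ
tallyTop    m a b = length (filter (λ w → precedes? (extendTop (suc m) w) a b) (avoiders (suc m)))
tallyBottom m a b = length (filter (λ w → precedes? (extendBottom w) a b) (avoiders (suc m)))

tally-step : ∀ m a b → tally (suc (suc m)) a b ≡ tallyTop m a b + tallyBottom m a b
tally-step m a b = begin
  tally (suc (suc m)) a b
    ≡⟨ cong length (filter-++ P? (map top G) (map extendBottom G)) ⟩
  length (filter P? (map top G) ++ filter P? (map extendBottom G))
    ≡⟨ length-++ (filter P? (map top G)) ⟩
  length (filter P? (map top G)) + length (filter P? (map extendBottom G))
    ≡⟨ cong₂ _+_ (length-filter-map P? top G) (length-filter-map P? extendBottom G) ⟩
  tallyTop m a b + tallyBottom m a b                               ∎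
  where
  open ≡-Reasoning
  P? : U.Decidable (λ w → Precedes w a b)
  P? w = precedes? w a b
  top : OneLine → OneLine
  top = extendTop (suc m)
  G : List OneLine
  G = avoiders (suc m)

tallyTop-last : ∀ m {a} → InRange (suc m) a → tallyTop m a (suc (suc m)) ≡ length (avoiders (suc m))
tallyTop-last m (1≤a , a≤) =
  length-filter-all _ λ w∈ → Precedes-∷ʳ-last _ _ (IsPerm.onto (avoiders-isPerm m w∈) 1≤a a≤)

tallyTop-other : ∀ m a {b} → b ≢ suc (suc m) → tallyTop m a b ≡ tally (suc m) a b
tallyTop-other m a {b} b≢ =
  length-filter-cong (λ w → precedes? (extendTop (suc m) w) a b) (λ w → precedes? w a b) (avoiders (suc m))
    λ _ → Precedes-∷ʳ _ _ b≢

tallyBottom-first : ∀ m {a} → InRange (suc m) a → tallyBottom m (suc a) 1 ≡ length (avoiders (suc m))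
tallyBottom-first m (1≤a , a≤) =
  length-filter-all _ λ w∈ → Precedes-∷ʳ-last _ 1 (∈-map⁺ suc (IsPerm.onto (avoiders-isPerm m w∈) 1≤a a≤))

tallyBottom-shift : ∀ m a b → tallyBottom m (suc a) (suc (suc b)) ≡ tally (suc m) a (suc b)
tallyBottom-shift m a b =
  length-filter-cong (λ w → precedes? (extendBottom w) (suc a) (suc (suc b))) (λ w → precedes? w a (suc b))
                     (avoiders (suc m))
    λ _ → ⇔.trans (Precedes-∷ʳ _ 1 λ ()) (mk⇔ Precedes-map-suc⁻ Precedes-map-suc⁺)

tally-outˡ : ∀ m {a} b → ¬ InRange (suc m) a → tally (suc m) a b ≡ 0
tally-outˡ m b a∉ = length-filter-none _ λ w∈ p → a∉ (IsPerm.bounded (avoiders-isPerm m w∈) (Precedes⇒∈ˡ p))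

tally-outʳ : ∀ m a {b} → ¬ InRange (suc m) b → tally (suc m) a b ≡ 0
tally-outʳ m a b∉ = length-filter-none _ λ w∈ p → b∉ (IsPerm.bounded (avoiders-isPerm m w∈) (Precedes⇒∈ʳ p))

tally-diag : ∀ m a → tally (suc m) a a ≡ 0
tally-diag m a = length-filter-none _ λ w∈ → Precedes-irrefl (IsPerm.unique (avoiders-isPerm m w∈))

complement-≤ : ∀ {a b n} → a + b ≡ suc n → 1 ≤ a → b ≤ n
complement-≤ {suc a} {b} eq _ = subst (b ≤_) (suc-injective eq) (m≤n+m b a)

complement-≥1 : ∀ {a b n} → a + b ≡ suc n → a ≤ n → 1 ≤ b
complement-≥1 {a} {zero}  eq a≤n = ⊥-elim (1+n≰n (subst (_≤ _) (trans (sym (+-identityʳ a)) eq) a≤n))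
complement-≥1 {a} {suc b} eq a≤n = s≤s z≤n

inRange-complement : ∀ {a b n} → a + b ≡ suc n → InRange n a → InRange n b
inRange-complement eq (1≤a , a≤n) = complement-≥1 eq a≤n , complement-≤ eq 1≤a

+-suc-injective : ∀ {a b n} → a + suc b ≡ suc n → a + b ≡ n
+-suc-injective {a} {b} eq = suc-injective (trans (sym (+-suc a b)) eq)

-- Reflecting x ↦ n + 1 - x maps the avoiders onto themselves, exchanging extendTop and extendBottom.
tally-reflect : ∀ m {a a′ b b′} → a + a′ ≡ suc (suc m) → b + b′ ≡ suc (suc m) →
  tally (suc m) a b ≡ tally (suc m) a′ b′
tallyTop≡tallyBottom : ∀ m {a a′ b b′} → a + a′ ≡ suc (suc (suc m)) → b + b′ ≡ suc (suc (suc m)) →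
  InRange (suc (suc m)) a → InRange (suc (suc m)) b → a ≢ b → tallyTop m a b ≡ tallyBottom m a′ b′

tally-reflect zero {a} {a′} {b} {b′} _ _ = trans (no-precedence a b) (sym (no-precedence a′ b′))
  where
  no-precedence : ∀ a b → tally 1 a b ≡ 0
  no-precedence a b =
    length-filter-none (λ w → precedes? w a b) {avoiders 1} λ { (here refl) (now ()) ; (here refl) (later ()) }
tally-reflect (suc m) {a} {a′} {b} {b′} a+a′ b+b′ with inRange? (suc (suc m)) a | inRange? (suc (suc m)) b
... | no a∉ | _ =
  trans (tally-outˡ (suc m) b a∉) (sym (tally-outˡ (suc m) b′ (a∉ ∘ inRange-complement (trans (+-comm a′ a) a+a′))))
... | yes _ | no b∉ =
  trans (tally-outʳ (suc m) a b∉) (sym (tally-outʳ (suc m) a′ (b∉ ∘ inRange-complement (trans (+-comm b′ b) b+b′))))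
... | yes a∈ | yes b∈ with a ≟ b
...   | yes refl rewrite +-cancelˡ-≡ a a′ b′ (trans a+a′ (sym b+b′)) =
  trans (tally-diag (suc m) a) (sym (tally-diag (suc m) b′))
...   | no a≢b = begin
  tally (suc (suc m)) a b                  ≡⟨ tally-step m a b ⟩
  tallyTop m a b + tallyBottom m a b       ≡⟨ cong₂ _+_ (tallyTop≡tallyBottom m a+a′ b+b′ a∈ b∈ a≢b)
                                                        (sym (tallyTop≡tallyBottom m a′+a b′+b a′∈ b′∈ a′≢b′)) ⟩
  tallyBottom m a′ b′ + tallyTop m a′ b′   ≡⟨ +-comm (tallyBottom m a′ b′) (tallyTop m a′ b′) ⟩
  tallyTop m a′ b′ + tallyBottom m a′ b′   ≡⟨ tally-step m a′ b′ ⟨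
  tally (suc (suc m)) a′ b′                ∎
  where
  open ≡-Reasoning
  a′+a : a′ + a ≡ suc (suc (suc m))
  a′+a = trans (+-comm a′ a) a+a′
  b′+b : b′ + b ≡ suc (suc (suc m))
  b′+b = trans (+-comm b′ b) b+b′
  a′∈ : InRange (suc (suc m)) a′
  a′∈ = inRange-complement a+a′ a∈
  b′∈ : InRange (suc (suc m)) b′
  b′∈ = inRange-complement b+b′ b∈
  a′≢b′ : a′ ≢ b′
  a′≢b′ refl = a≢b (+-cancelʳ-≡ a′ a b (trans a+a′ (sym b+b′)))

tallyTop≡tallyBottom m {a′ = zero} a+a′ _ (_ , a≤) _ _ with () ← complement-≥1 a+a′ a≤
tallyTop≡tallyBottom m {b′ = zero} _ b+b′ _ (_ , b≤) _ with () ← complement-≥1 b+b′ b≤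
tallyTop≡tallyBottom m {a} {suc a″} {b} {suc zero} a+a′ b+b′ (1≤a , a≤) _ a≢b
  with refl ← +-cancelʳ-≡ 1 b (suc (suc m)) (trans b+b′ (+-comm 1 (suc (suc m)))) =
  trans (tallyTop-last m a∈) (sym (tallyBottom-first m (inRange-complement (+-suc-injective a+a′) a∈)))
  where
  a∈ : InRange (suc m) a
  a∈ = 1≤a , ≤-pred (≤∧≢⇒< a≤ a≢b)
tallyTop≡tallyBottom m {a} {suc a″} {b} {suc (suc b″)} a+a′ b+b′ _ _ _ =
  trans (tallyTop-other m a b≢N)
        (trans (tally-reflect m (+-suc-injective {a} {a″} a+a′) b+b″) (sym (tallyBottom-shift m a″ b″)))
  where
  b+b″ : b + suc b″ ≡ suc (suc m)
  b+b″ = +-suc-injective {b} {suc b″} b+b′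
  b≢N : b ≢ suc (suc m)
  b≢N refl = <-irrefl refl (subst (suc (suc m) <_) b+b″ (m<m+n (suc (suc m)) {suc b″} (s≤s z≤n)))

-- Distance from the centre

CloserToCentre : ℕ → ℕ → ℕ → Set
CloserToCentre n a b = (b < a × a + b < suc n) ⊎ (a < b × suc n < a + b)

AsCentral : ℕ → ℕ → ℕ → Set
AsCentral n a b = CloserToCentre n a b ⊎ a + b ≡ suc n ⊎ a ≡ b

closer-irrefl : ∀ {n a} → ¬ CloserToCentre n a a
closer-irrefl (inj₁ (a<a , _)) = <-irrefl refl a<a
closer-irrefl (inj₂ (a<a , _)) = <-irrefl refl a<a

closer-trichotomy : ∀ n a b → CloserToCentre n a b ⊎ CloserToCentre n b a ⊎ a + b ≡ suc n ⊎ a ≡ b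
closer-trichotomy n a b with <-cmp a b | <-cmp (a + b) (suc n)
... | tri≈ _ a≡b _ | _              = inj₂ (inj₂ (inj₂ a≡b))
... | tri< a<b _ _ | tri< a+b< _ _  = inj₂ (inj₁ (inj₁ (a<b , subst (_< suc n) (+-comm a b) a+b<)))
... | tri< _ _ _   | tri≈ _ a+b≡ _  = inj₂ (inj₂ (inj₁ a+b≡))
... | tri< a<b _ _ | tri> _ _ <a+b  = inj₁ (inj₂ (a<b , <a+b))
... | tri> _ _ b<a | tri< a+b< _ _  = inj₁ (inj₁ (b<a , a+b<))
... | tri> _ _ _   | tri≈ _ a+b≡ _  = inj₂ (inj₂ (inj₁ a+b≡))
... | tri> _ _ b<a | tri> _ _ <a+b  = inj₂ (inj₁ (inj₂ (b<a , subst (suc n <_) (+-comm a b) <a+b)))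

closer⇒interior : ∀ n {a b} → CloserToCentre (suc n) a b → 1 ≤ b → b ≤ suc n → 2 ≤ a × a ≤ n
closer⇒interior n {a} {b} (inj₁ (b<a , a+b<)) 1≤b _ =
  ≤-<-trans 1≤b b<a , ≤-pred (≤-pred (≤-<-trans (subst (_≤ a + b) (+-comm a 1) (+-monoʳ-≤ a 1≤b)) a+b<))
closer⇒interior n {a} {b} (inj₂ (a<b , <a+b)) _ b≤ =
  +-cancelʳ-< (suc n) 1 a (<-≤-trans <a+b (+-monoʳ-≤ a b≤)) , ≤-pred (<-≤-trans a<b b≤)

asCentral-last : ∀ n {a} → 1 ≤ a → a < n → AsCentral n a n
asCentral-last n {a} 1≤a a<n with m≤n⇒m<n∨m≡n (+-monoˡ-≤ n 1≤a)
... | inj₁ <a+n = inj₁ (inj₂ (a<n , <a+n))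
... | inj₂ a+n≡ = inj₂ (inj₁ (sym a+n≡))

asCentral-first : ∀ n {a} → 2 ≤ a → a ≤ n → AsCentral n a 1
asCentral-first n {a} 2≤a a≤n with m≤n⇒m<n∨m≡n (subst (_≤ suc n) (+-comm 1 a) (s≤s a≤n))
... | inj₁ a+1< = inj₁ (inj₁ (2≤a , a+1<))
... | inj₂ a+1≡ = inj₂ (inj₁ a+1≡)

-- tally-step compares a, b again in its top part and a - 1, b - 1 in its bottom part; at least one
-- of the two comparisons stays strict.
closer-shift : ∀ n {a b} → CloserToCentre (suc n) (suc a) (suc b) →
  (AsCentral n (suc a) (suc b) × CloserToCentre n a b) ⊎ (CloserToCentre n (suc a) (suc b) × AsCentral n a b)
closer-shift n {a} {b} (inj₁ (s≤s b<a , a+b<)) = inj₁ (asCentral , inj₁ (b<a , m<n⇒m<1+n a+b<n))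
  where
  a+b<n : a + b < n
  a+b<n = ≤-pred (≤-pred (subst (_< suc (suc n)) (cong suc (+-suc a b)) a+b<))
  asCentral : AsCentral n (suc a) (suc b)
  asCentral with m≤n⇒m<n∨m≡n (subst (_≤ suc n) (sym (cong suc (+-suc a b))) (s≤s a+b<n))
  ... | inj₁ sum< = inj₁ (inj₁ (s≤s b<a , sum<))
  ... | inj₂ sum≡ = inj₂ (inj₁ sum≡)
closer-shift n {a} {b} (inj₂ (s≤s a<b , <a+b)) =
  inj₂ ((inj₂ (s≤s a<b , subst (suc n <_) (sym (cong suc (+-suc a b))) (s≤s (s≤s (<⇒≤ n<a+b))))) , asCentral)
  where
  n<a+b : n < a + b
  n<a+b = ≤-pred (≤-pred (subst (suc (suc n) <_) (cong suc (+-suc a b)) <a+b))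
  asCentral : AsCentral n a b
  asCentral with m≤n⇒m<n∨m≡n n<a+b
  ... | inj₁ <a+b′ = inj₁ (inj₂ (a<b , <a+b′))
  ... | inj₂ a+b≡  = inj₂ (inj₁ (sym a+b≡))

tally-strict : ∀ m {a b} → InRange (suc m) a → InRange (suc m) b → CloserToCentre (suc m) a b →
  tally (suc m) b a < tally (suc m) a b
tally-weak : ∀ m {a b} → InRange (suc m) a → InRange (suc m) b → AsCentral (suc m) a b →
  tally (suc m) b a ≤ tally (suc m) a b
tally-strict-last : ∀ m {a″} → suc (suc a″) ≤ suc m →
  tally (suc (suc m)) (suc (suc m)) (suc (suc a″)) < tally (suc (suc m)) (suc (suc a″)) (suc (suc m))
tally-strict-first : ∀ m {a″} → suc (suc a″) ≤ suc m →
  tally (suc (suc m)) 1 (suc (suc a″)) < tally (suc (suc m)) (suc (suc a″)) 1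
tally-strict-inner : ∀ m {a″ b″} → suc (suc a″) ≤ suc m → suc (suc b″) ≤ suc m →
  CloserToCentre (suc (suc m)) (suc (suc a″)) (suc (suc b″)) →
  tally (suc (suc m)) (suc (suc b″)) (suc (suc a″)) < tally (suc (suc m)) (suc (suc a″)) (suc (suc b″))

tally-weak m a∈ b∈ (inj₁ closer)         = <⇒≤ (tally-strict m a∈ b∈ closer)
tally-weak m {a} {b} _ _ (inj₂ (inj₁ a+b≡)) = ≤-reflexive (tally-reflect m (trans (+-comm b a) a+b≡) a+b≡)
tally-weak m _ _ (inj₂ (inj₂ refl))      = ≤-refl

tally-strict zero    (s≤s z≤n , s≤s z≤n) (s≤s z≤n , s≤s z≤n) closer = ⊥-elim (closer-irrefl closer)
tally-strict (suc m) {a} {b} _ (1≤b , b≤) closer with closer⇒interior (suc m) closer 1≤b b≤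
tally-strict (suc m) {suc (suc a″)} {b} _ (1≤b , b≤) closer | s≤s (s≤s _) , a≤ with b ≟ suc (suc m)
... | yes refl = tally-strict-last m a≤
... | no b≢N = below b 1≤b (≤∧≢⇒< b≤ b≢N) closer
  where
  a : ℕ
  a = suc (suc a″)
  below : ∀ b → 1 ≤ b → b < suc (suc m) → CloserToCentre (suc (suc m)) a b →
          tally (suc (suc m)) b a < tally (suc (suc m)) a b
  below (suc zero)     _ _         _      = tally-strict-first m a≤
  below (suc (suc b″)) _ (s≤s b≤m) closer = tally-strict-inner m a≤ b≤m closer

tally-strict-last m {a″} a≤ = begin-strict
  tally N N a                                  ≡⟨ tally-step m N a ⟩
  tallyTop m N a + tallyBottom m N a           ≡⟨ cong₂ _+_ top-vanishes (tallyBottom-shift m (suc m) a″) ⟩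
  tally (suc m) (suc m) a′                     ≤⟨ tally-weak m a′∈ (s≤s z≤n , ≤-refl) a′-vs-last ⟩
  tally (suc m) a′ (suc m)                     <⟨ m<n+m _ (avoiders-nonempty m) ⟩
  length (avoiders (suc m)) + tally (suc m) a′ (suc m)
                                               ≡⟨ cong₂ _+_ (tallyTop-last m a∈) (tallyBottom-shift m a′ m) ⟨
  tallyTop m a N + tallyBottom m a N           ≡⟨ tally-step m a N ⟨
  tally N a N                                  ∎
  where
  open ≤-Reasoning
  N a a′ : ℕ
  N  = suc (suc m)
  a  = suc (suc a″)
  a′ = suc a″
  a∈ : InRange (suc m) a
  a∈ = s≤s z≤n , a≤
  a′∈ : InRange (suc m) a′
  a′∈ = s≤s z≤n , ≤-pred (m≤n⇒m≤1+n a≤)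
  top-vanishes : tallyTop m N a ≡ 0
  top-vanishes = trans (tallyTop-other m N (<⇒≢ (s≤s a≤))) (tally-outˡ m a λ (_ , N≤) → 1+n≰n N≤)
  a′-vs-last : AsCentral (suc m) a′ (suc m)
  a′-vs-last = asCentral-last (suc m) (s≤s z≤n) a≤

tally-strict-first m {a″} a≤ = begin-strict
  tally N 1 a                                  ≡⟨ tally-step m 1 a ⟩
  tallyTop m 1 a + tallyBottom m 1 a           ≡⟨ cong₂ _+_ (tallyTop-other m 1 (<⇒≢ (s≤s a≤))) bottom-vanishes ⟩
  tally (suc m) 1 a + 0                        ≡⟨ +-identityʳ _ ⟩
  tally (suc m) 1 a                            ≤⟨ tally-weak m a∈ (s≤s z≤n , s≤s z≤n) a-vs-first ⟩
  tally (suc m) a 1                            <⟨ m<m+n _ (avoiders-nonempty m) ⟩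
  tally (suc m) a 1 + length (avoiders (suc m))
                                               ≡⟨ cong₂ _+_ (tallyTop-other m a λ ()) (tallyBottom-first m a′∈) ⟨
  tallyTop m a 1 + tallyBottom m a 1           ≡⟨ tally-step m a 1 ⟨
  tally N a 1                                  ∎
  where
  open ≤-Reasoning
  N a : ℕ
  N = suc (suc m)
  a = suc (suc a″)
  a∈ : InRange (suc m) a
  a∈ = s≤s z≤n , a≤
  a′∈ : InRange (suc m) (suc a″)
  a′∈ = s≤s z≤n , ≤-pred (m≤n⇒m≤1+n a≤)
  bottom-vanishes : tallyBottom m 1 a ≡ 0
  bottom-vanishes = trans (tallyBottom-shift m 0 a″) (tally-outˡ m (suc a″) λ ())
  a-vs-first : AsCentral (suc m) a 1
  a-vs-first = asCentral-first (suc m) (s≤s (s≤s z≤n)) a≤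

tally-strict-inner m {a″} {b″} a≤ b≤ closer = begin-strict
  tally N b a                                  ≡⟨ tally-step m b a ⟩
  tallyTop m b a + tallyBottom m b a
    ≡⟨ cong₂ _+_ (tallyTop-other m b (<⇒≢ (s≤s a≤))) (tallyBottom-shift m b′ a″) ⟩
  tally (suc m) b a + tally (suc m) b′ a′      <⟨ both-levels (closer-shift (suc m) closer) ⟩
  tally (suc m) a b + tally (suc m) a′ b′
    ≡⟨ cong₂ _+_ (tallyTop-other m a (<⇒≢ (s≤s b≤))) (tallyBottom-shift m a′ b″) ⟨
  tallyTop m a b + tallyBottom m a b           ≡⟨ tally-step m a b ⟨
  tally N a b                                  ∎
  where
  open ≤-Reasoning
  N a b a′ b′ : ℕ
  N  = suc (suc m)
  a  = suc (suc a″)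
  b  = suc (suc b″)
  a′ = suc a″
  b′ = suc b″
  a∈ : InRange (suc m) a
  a∈ = s≤s z≤n , a≤
  b∈ : InRange (suc m) b
  b∈ = s≤s z≤n , b≤
  a′∈ : InRange (suc m) a′
  a′∈ = s≤s z≤n , ≤-pred (m≤n⇒m≤1+n a≤)
  b′∈ : InRange (suc m) b′
  b′∈ = s≤s z≤n , ≤-pred (m≤n⇒m≤1+n b≤)
  both-levels : (AsCentral (suc m) a b × CloserToCentre (suc m) a′ b′) ⊎
                (CloserToCentre (suc m) a b × AsCentral (suc m) a′ b′) →
                tally (suc m) b a + tally (suc m) b′ a′ < tally (suc m) a b + tally (suc m) a′ b′
  both-levels (inj₁ (as , closer′)) = +-mono-≤-< (tally-weak m a∈ b∈ as) (tally-strict m a′∈ b′∈ closer′)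
  both-levels (inj₂ (closer′ , as)) = +-mono-<-≤ (tally-strict m a∈ b∈ closer′) (tally-weak m a′∈ b′∈ as)

tally-majority⇔closer : ∀ m {a b} → InRange (suc m) a → InRange (suc m) b →
  tally (suc m) b a < tally (suc m) a b ⇔ CloserToCentre (suc m) a b
tally-majority⇔closer m {a} {b} a∈ b∈ = mk⇔ majority⇒closer (tally-strict m a∈ b∈)
  where
  majority⇒closer : tally (suc m) b a < tally (suc m) a b → CloserToCentre (suc m) a b
  majority⇒closer ba<ab with closer-trichotomy (suc m) a b
  ... | inj₁ closer             = closer
  ... | inj₂ (inj₁ closer)      = ⊥-elim (<-asym ba<ab (tally-strict m b∈ a∈ closer))
  ... | inj₂ (inj₂ (inj₁ a+b≡)) = ⊥-elim (<-irrefl (tally-reflect m (trans (+-comm b a) a+b≡) a+b≡) ba<ab)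
  ... | inj₂ (inj₂ (inj₂ refl)) = ⊥-elim (<-irrefl refl ba<ab)

block : ℕ → ℕ → List ℕ
block n t = t ∷ (suc n ∸ t) ∷ []

∈-block⁻ : ∀ n {a t} → t ≤ suc n → a ∈ block n t → a ≡ t ⊎ a + t ≡ suc n
∈-block⁻ n t≤       (here refl)         = inj₁ refl
∈-block⁻ n {t = t} t≤ (there (here refl)) = inj₂ (m∸n+n≡m t≤)

∈-block⁺ : ∀ n {a t} → a ≡ t ⊎ a + t ≡ suc n → a ∈ block n t
∈-block⁺ n         (inj₁ refl) = here refl
∈-block⁺ n {a} {t} (inj₂ a+t≡) = there (here (sym (trans (cong (_∸ t) (sym a+t≡)) (m+n∸n≡m a t))))

InSomeBlock : ℕ → List (List ℕ) → Set
InSomeBlock b Bs = Σ (Fin (length Bs)) λ s → b ∈ lookup Bs s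

prelinear-∷⁻ : ∀ X Bs {a b} → Prelinear (X ∷ Bs) a b → (a ∈ X × InSomeBlock b Bs) ⊎ Prelinear Bs a b
prelinear-∷⁻ X Bs (Fin.zero  , Fin.suc s , _       , a∈ , b∈) = inj₁ (a∈ , s , b∈)
prelinear-∷⁻ X Bs (Fin.suc r , Fin.suc s , s≤s r<s , a∈ , b∈) = inj₂ (r , s , r<s , a∈ , b∈)

prelinear-∷⁺ : ∀ X Bs {a b} → (a ∈ X × InSomeBlock b Bs) ⊎ Prelinear Bs a b → Prelinear (X ∷ Bs) a b
prelinear-∷⁺ X Bs (inj₁ (a∈ , s , b∈))         = Fin.zero , Fin.suc s , s≤s z≤n , a∈ , b∈
prelinear-∷⁺ X Bs (inj₂ (r , s , r<s , a∈ , b∈)) = Fin.suc r , Fin.suc s , s≤s r<s , a∈ , b∈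

inSomeBlock⁻ : ∀ n k {b} → InSomeBlock b (map (block n) (desc k)) → Σ ℕ λ s → InRange k s × b ∈ block n s
inSomeBlock⁻ n (suc k) (Fin.zero  , b∈) = suc k , (s≤s z≤n , ≤-refl) , b∈
inSomeBlock⁻ n (suc k) (Fin.suc s , b∈) with s′ , (1≤s′ , s′≤k) , b∈′ ← inSomeBlock⁻ n k (s , b∈) =
  s′ , (1≤s′ , m≤n⇒m≤1+n s′≤k) , b∈′

inSomeBlock⁺ : ∀ n k {b s} → InRange k s → b ∈ block n s → InSomeBlock b (map (block n) (desc k))
inSomeBlock⁺ n zero    (1≤s , s≤0) _ = ⊥-elim (1+n≰n (≤-trans 1≤s s≤0))
inSomeBlock⁺ n (suc k) (1≤s , s≤) b∈ with m≤n⇒m<n∨m≡n s≤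
... | inj₂ refl     = Fin.zero , b∈
... | inj₁ (s≤s s≤k) with i , b∈′ ← inSomeBlock⁺ n k (1≤s , s≤k) b∈ = Fin.suc i , b∈′

BlockOrdered : ℕ → ℕ → ℕ → ℕ → Set
BlockOrdered n k a b = Σ ℕ λ t → Σ ℕ λ s → 1 ≤ s × s < t × t ≤ k × a ∈ block n t × b ∈ block n s

prelinear-blocks⁻ : ∀ n k {a b} → Prelinear (map (block n) (desc k)) a b → BlockOrdered n k a b
prelinear-blocks⁻ n (suc k) p with prelinear-∷⁻ (block n (suc k)) (map (block n) (desc k)) p
... | inj₁ (a∈ , b∈some) with s , (1≤s , s≤k) , b∈ ← inSomeBlock⁻ n k b∈some =
  suc k , s , 1≤s , s≤s s≤k , ≤-refl , a∈ , b∈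
... | inj₂ p′ with t , s , 1≤s , s<t , t≤k , a∈ , b∈ ← prelinear-blocks⁻ n k p′ =
  t , s , 1≤s , s<t , m≤n⇒m≤1+n t≤k , a∈ , b∈

prelinear-blocks⁺ : ∀ n k {a b} → BlockOrdered n k a b → Prelinear (map (block n) (desc k)) a b
prelinear-blocks⁺ n zero    (_ , _ , _ , s<t , z≤n , _) = ⊥-elim (n≮0 s<t)
prelinear-blocks⁺ n (suc k) (t , s , 1≤s , s<t , t≤ , a∈ , b∈) with m≤n⇒m<n∨m≡n t≤
... | inj₂ refl =
  prelinear-∷⁺ (block n t) (map (block n) (desc k)) (inj₁ (a∈ , inSomeBlock⁺ n k (1≤s , ≤-pred s<t) b∈))
... | inj₁ (s≤s t≤k) =
  prelinear-∷⁺ (block n (suc k)) (map (block n) (desc k))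
    (inj₂ (prelinear-blocks⁺ n k (t , s , 1≤s , s<t , t≤k , a∈ , b∈)))

double≤⇒≤half : ∀ {t N} → t + t ≤ N → t ≤ ⌊ N /2⌋
double≤⇒≤half {t} t+t≤ = subst (_≤ _) (sym (n≡⌊n+n/2⌋ t)) (⌊n/2⌋-mono t+t≤)

≤half⇒double≤ : ∀ {t N} → t ≤ ⌊ N /2⌋ → t + t ≤ N
≤half⇒double≤ {t} {N} t≤ = begin
  t + t               ≤⟨ +-mono-≤ t≤ (≤-trans t≤ (⌊n/2⌋≤⌈n/2⌉ N)) ⟩
  ⌊ N /2⌋ + ⌈ N /2⌉   ≡⟨ ⌊n/2⌋+⌈n/2⌉≡n N ⟩
  N                   ∎
  where open ≤-Reasoning

blocks⇒closer : ∀ n {a b t s} → s < t → t + t ≤ suc n →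
  (a ≡ t ⊎ a + t ≡ suc n) → (b ≡ s ⊎ b + s ≡ suc n) → CloserToCentre n a b
blocks⇒closer n {t = t} {s} s<t t+t≤ (inj₁ refl) (inj₁ refl) =
  inj₁ (s<t , <-≤-trans (+-monoʳ-< t s<t) t+t≤)
blocks⇒closer n {b = b} {t} {s} s<t t+t≤ (inj₁ refl) (inj₂ b+s≡) =
  inj₂ (+-cancelʳ-< s t b (<-≤-trans (+-monoʳ-< t s<t) (subst (t + t ≤_) (sym b+s≡) t+t≤)) ,
        subst (_< t + b) b+s≡ (subst (b + s <_) (+-comm b t) (+-monoʳ-< b s<t)))
blocks⇒closer n {a} {t = t} {s} s<t t+t≤ (inj₂ a+t≡) (inj₁ refl) =
  inj₁ (+-cancelʳ-< t s a (<-≤-trans (+-monoˡ-< t s<t) (subst (t + t ≤_) (sym a+t≡) t+t≤)) ,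
        subst (a + s <_) a+t≡ (+-monoʳ-< a s<t))
blocks⇒closer n {a} {b} {t} {s} s<t t+t≤ (inj₂ a+t≡) (inj₂ b+s≡) =
  inj₂ (+-cancelʳ-< s a b (subst (a + s <_) (trans a+t≡ (sym b+s≡)) (+-monoʳ-< a s<t)) ,
        +-cancelʳ-< (t + s) (suc n) (a + b) (subst (suc n + (t + s) <_) sums (+-monoʳ-< (suc n) t+s<)))
  where
  t+s< : t + s < suc n
  t+s< = <-≤-trans (+-monoʳ-< t s<t) t+t≤
  sums : suc n + suc n ≡ (a + b) + (t + s)
  sums = trans (cong₂ _+_ (sym a+t≡) (sym b+s≡)) (interchange a t b s)

block-of : ∀ {N} a → a ≤ N → Σ ℕ λ t → t + t ≤ N × (a ≡ t ⊎ a + t ≡ N)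
block-of {N} a a≤N with a + a ≤? N
... | yes a+a≤ = a , a+a≤ , inj₁ refl
... | no  a+a≰ = N ∸ a , <⇒≤ y+y<N , inj₂ a+y≡
  where
  a+y≡ : a + (N ∸ a) ≡ N
  a+y≡ = m+[n∸m]≡n a≤N
  y+y<N : (N ∸ a) + (N ∸ a) < N
  y+y<N = +-cancelˡ-< N _ N (subst (N + ((N ∸ a) + (N ∸ a)) <_)
            (trans (sym (interchange a (N ∸ a) a (N ∸ a))) (cong₂ _+_ a+y≡ a+y≡))
            (+-monoˡ-< _ (≰⇒> a+a≰)))

closer⇒blocks : ∀ n {a b} → a ≤ n → 1 ≤ b → b ≤ n → CloserToCentre n a b →
  Σ ℕ λ t → Σ ℕ λ s → 1 ≤ s × s < t × t + t ≤ suc n × (a ≡ t ⊎ a + t ≡ suc n) × (b ≡ s ⊎ b + s ≡ suc n)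
closer⇒blocks n {a} {b} a≤n 1≤b b≤n (inj₁ (b<a , a+b<)) with block-of {suc n} a (m≤n⇒m≤1+n a≤n)
... | t , t+t≤ , inj₁ refl = t , b , 1≤b , b<a , t+t≤ , inj₁ refl , inj₁ refl
... | t , t+t≤ , inj₂ a+t≡ =
  t , b , 1≤b , +-cancelˡ-< a b t (subst (a + b <_) (sym a+t≡) a+b<) , t+t≤ , inj₂ a+t≡ , inj₁ refl
closer⇒blocks n {a} {b} a≤n 1≤b b≤n (inj₂ (a<b , <a+b)) with block-of {suc n} a (m≤n⇒m≤1+n a≤n)
... | t , t+t≤ , a∈t = t , suc n ∸ b , 1≤z , z<t a∈t , t+t≤ , a∈t , inj₂ b+z≡
  where
  b+z≡ : b + (suc n ∸ b) ≡ suc n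
  b+z≡ = m+[n∸m]≡n (m≤n⇒m≤1+n b≤n)
  1≤z : 1 ≤ suc n ∸ b
  1≤z = complement-≥1 b+z≡ b≤n
  z<t : a ≡ t ⊎ a + t ≡ suc n → suc n ∸ b < t
  z<t (inj₁ refl) = +-cancelˡ-< b _ t (subst (_< b + t) (sym b+z≡) (subst (suc n <_) (+-comm t b) <a+b))
  z<t (inj₂ a+t≡) = +-cancelˡ-< b _ t (subst (_< b + t) (trans a+t≡ (sym b+z≡)) (+-monoˡ-< t a<b))

prelinear⇔closer : ∀ n {a b} → a ≤ n → InRange n b → Prelinear (partBlocks n) a b ⇔ CloserToCentre n a b
prelinear⇔closer n {a} {b} a≤n (1≤b , b≤n) = mk⇔ prelinear⇒closer closer⇒prelinear
  where
  prelinear⇒closer : Prelinear (partBlocks n) a b → CloserToCentre n a b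
  prelinear⇒closer p with t , s , _ , s<t , t≤ , a∈ , b∈ ← prelinear-blocks⁻ n ⌈ n /2⌉ p =
    blocks⇒closer n s<t t+t≤ (∈-block⁻ n t≤n+1 a∈) (∈-block⁻ n (≤-trans (<⇒≤ s<t) t≤n+1) b∈)
    where
    t+t≤ : t + t ≤ suc n
    t+t≤ = ≤half⇒double≤ t≤
    t≤n+1 : t ≤ suc n
    t≤n+1 = m+n≤o⇒m≤o t t+t≤
  closer⇒prelinear : CloserToCentre n a b → Prelinear (partBlocks n) a b
  closer⇒prelinear closer with t , s , 1≤s , s<t , t+t≤ , a∈ , b∈ ← closer⇒blocks n a≤n 1≤b b≤n closer =
    prelinear-blocks⁺ n ⌈ n /2⌉ (t , s , 1≤s , s<t , double≤⇒≤half t+t≤ , ∈-block⁺ n a∈ , ∈-block⁺ n b∈)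

uniformMajority⇔tally : ∀ m a b →
  UniformMajority (suc m) (mWord (suc m)) a b ⇔ tally (suc m) b a < tally (suc m) a b
uniformMajority⇔tally m a b = mk⇔
  (λ (_ , _ , size-ab , size-ba , ba<ab) →
     subst₂ _<_ (hasSize-unique size-ba (tally-hasSize m b a)) (hasSize-unique size-ab (tally-hasSize m a b)) ba<ab)
  (λ ba<ab → tally (suc m) a b , tally (suc m) b a , tally-hasSize m a b , tally-hasSize m b a , ba<ab)

proposition4p3 : (n a b : ℕ) → 1 ≤ a → a ≤ n → 1 ≤ b → b ≤ n →
    UniformMajority n (mWord n) a b ⇔ Prelinear (partBlocks n) a b
proposition4p3 zero    a b 1≤a a≤0 _ _ = ⊥-elim (1+n≰n (≤-trans 1≤a a≤0))
proposition4p3 (suc m) a b 1≤a a≤n 1≤b b≤n =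
  uniformMajority⇔tally m a b
    ⟨ ⇔.trans ⟩ tally-majority⇔closer m (1≤a , a≤n) (1≤b , b≤n)
    ⟨ ⇔.trans ⟩ ⇔.sym (prelinear⇔closer (suc m) a≤n (1≤b , b≤n))
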